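{- Let $k$ be a field of characteristic zero and let $H_{\mathcal{C}}$ be the $k$-vector space with basis the set $\mathcal{C}$ of isomorphism classes of multi-complexes, equipped with the product $[C]\cdot[D]=[C\sqcup D]$, unit $[\emptyset]$, coproduct $\Delta([C])=\sum_{X\sqcup Y=n_C}[C|_X]\otimes[C|_Y]$ (sum over ordered pairs $(X,Y)$ of disjoint subsets of $n_C$ with $X\cup Y=n_C$), extended linearly, and counit $\varepsilon([C])=1$ if $n_C=\emptyset$ and $\varepsilon([C])=0$ otherwise. Then $H_{\mathcal{C}}$ is a Hopf algebra.
   Context: A multiset based on a set $S$ is a function $S\to\{1,2,3,\dots\}$; $S$ is its support $\mathrm{supp}$. A multi-complex $C$ consists of a finite base set $n_C$, a finite family $\{A_i\}_{i\in I}$ of non-empty multisets (repetitions allowed) whose supports are subsets of $n_C$, and a partial order $\preceq$ on this family such that (1) for each $k\in n_C$ the singleton $\{k\}$ occurs exactly once among the $A_i$, and $\{k\}\preceq A_i$ iff $k$ belongs to $A_i$; (2) if $A_i\preceq A_j$ then $A_i$ is contained in $A_j$. The empty family is the unique multi-complex based on $\emptyset$. An isomorphism of multi-complexes is a bijection of base sets inducing a bijection of the families (sending $A_i$ to a member equal to its image) which preserves and reflects $\preceq$. The disjoint union $C\sqcup D$ is based on $n_C\sqcup n_D$ with family the disjoint union of the two families and order induced from $C$ and $D$. For $X\subseteq n_C$, the restriction $C|_X$ is the multi-complex based on $X$ consisting of those $A_i$ with $\mathrm{supp}(A_i)\subseteq X$, with the inherited order. -}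

module Defs where

open import Level using (Level; _⊔_) renaming (suc to lsuc)
open import Data.Nat using (ℕ; zero; suc; _≤_; _≡ᵇ_) renaming (_+_ to _+ℕ_)
open import Data.Fin using (Fin; zero; suc; splitAt)
open import Data.Bool using (Bool; true; false; not; _∨_; T)
open import Data.List using (List; []; _∷_; map; concatMap; allFin; foldr)
open import Data.Bool.ListAction using (and)
open import Data.Product using (Σ; ∃; _×_; _,_)
open import Data.Sum using (inj₁; inj₂)
open import Relation.Nullary using (¬_)
open import Relation.Binary.PropositionalEquality using (_≡_)
open import Function.Bundles using (_↔_; _⇔_; Inverse)
open import Algebra.Bundles using (CommutativeRing)
open import Data.Unit.Polymorphic using () renaming (⊤ to ⊤′)

record Field (c ℓ : Level) : Set (lsuc (c ⊔ ℓ)) where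
  field
    commutativeRing : CommutativeRing c ℓ
  open CommutativeRing commutativeRing public
  field
    0≉1     : ¬ (0# ≈ 1#)
    inverse : ∀ x → ¬ (x ≈ 0#) → ∃ λ y → (x * y) ≈ 1#

natF : ∀ {c ℓ} (K : Field c ℓ) → ℕ → Field.Carrier K
natF K zero    = Field.0# K
natF K (suc n) = Field._+_ K (Field.1# K) (natF K n)

CharZero : ∀ {c ℓ} → Field c ℓ → Set ℓ
CharZero K = ∀ n → Field._≈_ K (natF K n) (Field.0# K) → n ≡ 0

-- The base set n_C is represented by Fin n (up to isomorphism every finite
-- set is of this form); the family {A_i}_{i∈I} is indexed by I = Fin r.
-- A multiset A with support ⊆ n_C is a function Fin n → ℕ, the value 0
-- meaning "not in the support" (so A restricted to its support is a map
-- to {1,2,3,...}).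

record MC : Set where
  constructor mc
  field
    n  : ℕ
    r  : ℕ
    A  : Fin r → Fin n → ℕ
    le : Fin r → Fin r → Bool
open MC public

IsSingleton : ∀ {n} → (Fin n → ℕ) → Fin n → Set
IsSingleton f k = (f k ≡ 1) × (∀ k′ → ¬ (k′ ≡ k) → f k′ ≡ 0)

record IsMC (C : MC) : Set where
  field
    nonempty   : ∀ i → ∃ λ k → ¬ (A C i k ≡ 0)
    le-refl    : ∀ i → T (le C i i)
    le-antisym : ∀ i j → T (le C i j) → T (le C j i) → i ≡ j
    le-trans   : ∀ i j l → T (le C i j) → T (le C j l) → T (le C i l)
    singleton  : ∀ k → Σ (Fin (r C)) λ i →
                   IsSingleton (A C i) k × (∀ i′ → IsSingleton (A C i′) k → i′ ≡ i)
    singleton-le : ∀ k i j → IsSingleton (A C i) k → (T (le C i j) ⇔ (¬ (A C j k ≡ 0)))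
    contained  : ∀ i j → T (le C i j) → ∀ k → A C i k ≤ A C j k

record MCIso (C D : MC) : Set where
  field
    σ : Fin (n C) ↔ Fin (n D)
    τ : Fin (r C) ↔ Fin (r D)
    A-pres  : ∀ i k → A D (Inverse.to τ i) (Inverse.to σ k) ≡ A C i k
    le-pres : ∀ i j → le D (Inverse.to τ i) (Inverse.to τ j) ≡ le C i j

∅MC : MC
∅MC = mc 0 0 (λ ()) (λ ())

_⊔MC_ : MC → MC → MC
C ⊔MC D = mc (n C +ℕ n D) (r C +ℕ r D) A′ le′
  where
  A′ : Fin (r C +ℕ r D) → Fin (n C +ℕ n D) → ℕ
  A′ i k with splitAt (r C) i | splitAt (n C) k
  ... | inj₁ i₁ | inj₁ k₁ = A C i₁ k₁
  ... | inj₁ i₁ | inj₂ k₂ = 0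
  ... | inj₂ i₂ | inj₁ k₁ = 0
  ... | inj₂ i₂ | inj₂ k₂ = A D i₂ k₂
  le′ : Fin (r C +ℕ r D) → Fin (r C +ℕ r D) → Bool
  le′ i j with splitAt (r C) i | splitAt (r C) j
  ... | inj₁ i₁ | inj₁ j₁ = le C i₁ j₁
  ... | inj₁ i₁ | inj₂ j₂ = false
  ... | inj₂ i₂ | inj₁ j₁ = false
  ... | inj₂ i₂ | inj₂ j₂ = le D i₂ j₂

countB : Bool → ℕ → ℕ
countB true  m = suc m
countB false m = m

count : ∀ {n} → (Fin n → Bool) → ℕ
count {zero}  p = 0
count {suc n} p = countB (p zero) (count (λ k → p (suc k)))

embB : ∀ {m n} (b : Bool) → (Fin m → Fin n) → Fin (countB b m) → Fin (suc n)
embB true  f zero    = zero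
embB true  f (suc i) = suc (f i)
embB false f i       = suc (f i)

emb : ∀ {n} (p : Fin n → Bool) → Fin (count p) → Fin n
emb {zero}  p ()
emb {suc n} p = embB (p zero) (emb (λ k → p (suc k)))

suppIn : ∀ {n} → (Fin n → ℕ) → (Fin n → Bool) → Bool
suppIn {n} f X = and (map (λ k → X k ∨ (f k ≡ᵇ 0)) (allFin n))

-- restriction C|_X, the subset X being relabelled increasingly as Fin |X|
restrict : (C : MC) → (Fin (n C) → Bool) → MC
restrict C X =
  mc (count X) (count keep)
     (λ i k → A C (emb keep i) (emb X k))
     (λ i j → le C (emb keep i) (emb keep j))
  where
  keep : Fin (r C) → Bool
  keep i = suppIn (A C i) X

consB : ∀ {n} → Bool → (Fin n → Bool) → Fin (suc n) → Bool
consB b f zero    = b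
consB b f (suc k) = f k

subsets : ∀ n → List (Fin n → Bool)
subsets zero    = (λ ()) ∷ []
subsets (suc n) = concatMap (λ f → consB true f ∷ consB false f ∷ []) (subsets n)

-- Free vector spaces over a field on a set B of representatives, modulo
-- an equivalence relation R on B (here: isomorphism), i.e. the vector
-- space with basis B/R.

module FreeVS {c ℓ} (K : Field c ℓ) where
  open Field K

  FV : ∀ {a} → Set a → Set (c ⊔ a)
  FV B = List (Carrier × B)

  data Eqv {a r} {B : Set a} (R : B → B → Set r) : FV B → FV B → Set (c ⊔ ℓ ⊔ a ⊔ r) where
    e-refl  : ∀ {xs} → Eqv R xs xs
    e-sym   : ∀ {xs ys} → Eqv R xs ys → Eqv R ys xs
    e-trans : ∀ {xs ys zs} → Eqv R xs ys → Eqv R ys zs → Eqv R xs zs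
    e-cons  : ∀ {a a′ b b′ xs ys} → a ≈ a′ → R b b′ → Eqv R xs ys →
              Eqv R ((a , b) ∷ xs) ((a′ , b′) ∷ ys)
    e-swap  : ∀ {p q xs} → Eqv R (p ∷ q ∷ xs) (q ∷ p ∷ xs)
    e-zero  : ∀ {b xs} → Eqv R ((0# , b) ∷ xs) xs
    e-merge : ∀ {a a′ b xs} → Eqv R ((a , b) ∷ (a′ , b) ∷ xs) ((a + a′ , b) ∷ xs)

  R× : ∀ {a b r s} {A : Set a} {B : Set b} → (A → A → Set r) → (B → B → Set s) →
       A × B → A × B → Set (r ⊔ s)
  R× R S (x , y) (x′ , y′) = R x x′ × S y y′

  scale : ∀ {a} {B : Set a} → Carrier → FV B → FV B
  scale a = map (λ { (c′ , b) → (a * c′ , b) })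

  lin : ∀ {a b} {A : Set a} {B : Set b} → (A → FV B) → FV A → FV B
  lin f = concatMap (λ { (a , x) → scale a (f x) })

  bilin : ∀ {a b d} {A : Set a} {B : Set b} {D : Set d} →
          (A → B → FV D) → FV A → FV B → FV D
  bilin f xs ys = lin (λ x → lin (λ y → f x y) ys) xs

  linK : ∀ {a} {A : Set a} → (A → Carrier) → FV A → Carrier
  linK f = foldr (λ { (a , x) s → (a * f x) + s }) 0#

  _⊗L_ : ∀ {a b a′ b′} {A : Set a} {B : Set b} {A′ : Set a′} {B′ : Set b′} →
         (A → FV A′) → (B → FV B′) → FV (A × B) → FV (A′ × B′)
  f ⊗L g = lin (λ { (x , y) → bilin (λ x′ y′ → (1# , (x′ , y′)) ∷ []) (f x) (g y) })

  AllB : ∀ {a p} {B : Set a} → (B → Set p) → FV B → Set p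
  AllB P [] = ⊤′
  AllB P ((_ , b) ∷ xs) = P b × AllB P xs

module HC {c ℓ} (K : Field c ℓ) where
  open Field K
  open FreeVS K public

  H : Set c
  H = FV MC

  _≈H_ : H → H → Set (c ⊔ ℓ)
  _≈H_ = Eqv MCIso

  H⊗H : Set c
  H⊗H = FV (MC × MC)

  _≈H⊗H_ : H⊗H → H⊗H → Set (c ⊔ ℓ)
  _≈H⊗H_ = Eqv (R× MCIso MCIso)

  H⊗H⊗H : Set c
  H⊗H⊗H = FV (MC × (MC × MC))

  _≈H⊗H⊗H_ : H⊗H⊗H → H⊗H⊗H → Set (c ⊔ ℓ)
  _≈H⊗H⊗H_ = Eqv (R× MCIso (R× MCIso MCIso))

  InH : H → Set
  InH = AllB IsMC

  basis : MC → H
  basis C = (1# , C) ∷ []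

  unitH : H
  unitH = basis ∅MC

  η : Carrier → H
  η a = (a , ∅MC) ∷ []

  μ : H⊗H → H
  μ = lin (λ { (C , D) → basis (C ⊔MC D) })

  _·_ : H → H → H
  x · y = μ (bilin (λ C D → (1# , (C , D)) ∷ []) x y)

  Δb : MC → H⊗H
  Δb C = map (λ X → (1# , (restrict C X , restrict C (λ k → not (X k)))))
             (subsets (n C))

  Δ : H → H⊗H
  Δ = lin Δb

  εb : MC → Carrier
  εb C with n C
  ... | zero  = 1#
  ... | suc _ = 0#

  ε : H → Carrier
  ε = linK εb

  _·⊗_ : H⊗H → H⊗H → H⊗H
  x ·⊗ y = bilin (λ { (a , b) (c′ , d) → (1# , (a ⊔MC c′ , b ⊔MC d)) ∷ [] }) x y

  assocR : ∀ {A B D : Set} → FV ((A × B) × D) → FV (A × (B × D))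
  assocR = map (λ { (s , ((a , b) , d)) → (s , (a , (b , d))) })

  record IsHopfAlgebra : Set (c ⊔ ℓ) where
    field
      ∅-valid       : IsMC ∅MC
      ⊔-valid       : ∀ C D → IsMC C → IsMC D → IsMC (C ⊔MC D)
      restrict-valid : ∀ C X → IsMC C → IsMC (restrict C X)
      ⊔-iso         : ∀ C C′ D D′ → IsMC C → IsMC D →
                        MCIso C C′ → MCIso D D′ → MCIso (C ⊔MC D) (C′ ⊔MC D′)
      Δ-iso         : ∀ C C′ → IsMC C → MCIso C C′ → Δb C ≈H⊗H Δb C′
      ε-iso         : ∀ C C′ → IsMC C → MCIso C C′ → εb C ≈ εb C′
      ·-assoc  : ∀ x y z → InH x → InH y → InH z → ((x · y) · z) ≈H (x · (y · z))
      ·-unitˡ  : ∀ x → InH x → (unitH · x) ≈H x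
      ·-unitʳ  : ∀ x → InH x → (x · unitH) ≈H x
      Δ-coassoc : ∀ x → InH x →
                  assocR ((Δb ⊗L basis) (Δ x)) ≈H⊗H⊗H (basis ⊗L Δb) (Δ x)
      ε-counitˡ : ∀ x → InH x → lin (λ { (C , D) → (εb C , D) ∷ [] }) (Δ x) ≈H x
      ε-counitʳ : ∀ x → InH x → lin (λ { (C , D) → (εb D , C) ∷ [] }) (Δ x) ≈H x
      Δ-mult   : ∀ x y → InH x → InH y → Δ (x · y) ≈H⊗H (Δ x ·⊗ Δ y)
      Δ-unit   : Δ unitH ≈H⊗H ((1# , (∅MC , ∅MC)) ∷ [])
      ε-mult   : ∀ x y → InH x → InH y → ε (x · y) ≈ (ε x * ε y)
      ε-unit   : ε unitH ≈ 1#
      antipode : Σ (MC → H) λ S →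
                   (∀ C → IsMC C → InH (S C)) ×
                   (∀ C C′ → IsMC C → MCIso C C′ → S C ≈H S C′) ×
                   (∀ x → InH x → μ ((S ⊗L basis) (Δ x)) ≈H η (ε x)) ×
                   (∀ x → InH x → μ ((basis ⊗L S) (Δ x)) ≈H η (ε x))

module Submission where

-- The coproduct of [C] is a sum over the subsets X ⊆ n_C, i.e. over Boolean vectors v ∈ 2^{n_C}
-- (the complement being the negated vector), and every axiom reduces to an identity of such sums
-- plus three facts about restriction: it respects isomorphism, (C ⊔ D)|_{X ⊔ Y} ≅ C|_X ⊔ D|_Y
-- (so Δ is multiplicative), and (C|_X)|_Y ≅ C|_Y for Y ⊆ X (so Δ is coassociative: both iterated
-- coproducts become one sum over splittings of n_C into three parts). H is graded by |n_C| and
-- connected, hence has Takeuchi's antipode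
--   S[C] = - Σ_{X ≠ n_C} S[C|_X] · [C|_{n_C ∖ X}]   (n_C ≠ ∅),
-- a recursion on smaller multi-complexes.

open import Defs

open import Level using (_⊔_)
open import Data.Nat using (ℕ; zero; suc; _+_; _≤_; z≤n; s≤s; _≡ᵇ_) renaming (_≟_ to _≟ℕ_)
import Data.Nat.Properties as ℕP
open import Data.Bool using (Bool; true; false; not; _∨_; _∧_; T)
import Data.Bool.Properties as BoolP
open import Data.Bool.ListAction using (and)
open import Data.Fin using (Fin; zero; suc; _↑ˡ_; _↑ʳ_; splitAt)
import Data.Fin.Properties as FinP
open import Data.Fin.Permutation using (Permutation; remove; _⟨$⟩ʳ_; _⟨$⟩ˡ_; ↔⇒≡)
open import Data.Vec as Vec using (Vec; []; _∷_; lookup; tabulate; replicate; insertAt)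
import Data.Vec.Properties as VecP
open import Data.List as List using ([]; _∷_; _++_; map; concat; concatMap)
import Data.List.Properties as ListP
open import Data.Product using (Σ; ∃; _×_; _,_; proj₁; proj₂)
open import Data.Sum using (inj₁; inj₂)
open import Data.Empty using (⊥-elim)
open import Data.Unit using (⊤)
open import Relation.Binary.PropositionalEquality using (_≡_; _≢_; refl; sym; trans; cong; cong₂; subst)
open import Relation.Nullary using (¬_; yes; no)
open import Relation.Binary.Bundles using (Setoid)
import Relation.Binary.Reasoning.Setoid as SetoidReasoning
open import Function using (_∘_; id)
open import Function.Definitions using (Injective)
open import Function.Bundles using (Inverse; _↔_; mk↔ₛ′; _⇔_; mk⇔; Equivalence)
open import Function.Properties.Inverse using (↔-refl; ↔-sym; ↔-trans)

open Inverse using (to; from)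

to∘from : ∀ {m n} (σ : Fin m ↔ Fin n) y → to σ (from σ y) ≡ y
to∘from = Inverse.strictlyInverseˡ

from∘to : ∀ {m n} (σ : Fin m ↔ Fin n) x → from σ (to σ x) ≡ x
from∘to = Inverse.strictlyInverseʳ

to-injective : ∀ {m n} (σ : Fin m ↔ Fin n) → Injective _≡_ _≡_ (to σ)
to-injective σ {x} {y} eq = trans (sym (from∘to σ x)) (trans (cong (from σ) eq) (from∘to σ y))

permute : ∀ {m n} → Permutation m n → Vec Bool n → Vec Bool m
permute π v = tabulate (λ i → lookup v (π ⟨$⟩ʳ i))

permute-insertAt : ∀ {m n} (π : Permutation (suc m) (suc n)) (v : Vec Bool n) b →
                   permute π (insertAt v (π ⟨$⟩ʳ zero) b) ≡ b ∷ permute (remove zero π) v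
permute-insertAt π v b = cong₂ _∷_ (VecP.insertAt-lookup v (π ⟨$⟩ʳ zero) b)
  (VecP.tabulate-cong (λ i → trans
     (cong (lookup (insertAt v (π ⟨$⟩ʳ zero) b)) (sym (FinP.punchIn-punchOut _)))
     (VecP.insertAt-punchIn v (π ⟨$⟩ʳ zero) b _)))

map-not-tabulate : ∀ {m} (f : Fin m → Bool) → Vec.map not (tabulate f) ≡ tabulate (not ∘ f)
map-not-tabulate {zero} f = refl
map-not-tabulate {suc m} f = cong (not (f zero) ∷_) (map-not-tabulate (f ∘ suc))

map-not-permute : ∀ {m n} (π : Permutation m n) v → Vec.map not (permute π v) ≡ permute π (Vec.map not v)
map-not-permute π v = trans (map-not-tabulate _) (VecP.tabulate-cong (λ i → sym (VecP.lookup-map (π ⟨$⟩ʳ i) not v)))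

map-not-involutive : ∀ {m} (v : Vec Bool m) → Vec.map not (Vec.map not v) ≡ v
map-not-involutive [] = refl
map-not-involutive (true ∷ v) = cong (true ∷_) (map-not-involutive v)
map-not-involutive (false ∷ v) = cong (false ∷_) (map-not-involutive v)

count-nonzero : ∀ {m} (v : Vec Bool m) → v ≢ replicate m false → Σ ℕ λ k → count (lookup v) ≡ suc k
count-nonzero [] ne = ⊥-elim (ne refl)
count-nonzero (true ∷ v) ne = _ , refl
count-nonzero (false ∷ v) ne = count-nonzero v (λ eq → ne (cong (false ∷_) eq))

count-not-nonzero : ∀ {m} (v : Vec Bool m) → v ≢ replicate m true → Σ ℕ λ k → count (lookup (Vec.map not v)) ≡ suc k
count-not-nonzero [] ne = ⊥-elim (ne refl)
count-not-nonzero (false ∷ v) ne = _ , refl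
count-not-nonzero (true ∷ v) ne = count-not-nonzero v (λ eq → ne (cong (true ∷_) eq))

count-not-all : ∀ m → count (lookup (Vec.map not (replicate m true))) ≡ 0
count-not-all zero = refl
count-not-all (suc m) = count-not-all m

not-none : ∀ m k → lookup (Vec.map not (replicate m false)) k ≡ true
not-none (suc m) zero = refl
not-none (suc m) (suc k) = not-none m k

all-true : ∀ m k → lookup (replicate m true) k ≡ true
all-true m k = VecP.lookup-replicate k true

isAll : ∀ {m} → Vec Bool m → Bool
isAll [] = true
isAll (b ∷ v) = b ∧ isAll v

isAll⁻ : ∀ {m} (v : Vec Bool m) → isAll v ≡ true → ∀ k → lookup v k ≡ true
isAll⁻ (true ∷ v) a zero = refl
isAll⁻ (true ∷ v) a (suc k) = isAll⁻ v a k

isAll⁺ : ∀ {m} (v : Vec Bool m) → (∀ k → lookup v k ≡ true) → isAll v ≡ true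
isAll⁺ [] h = refl
isAll⁺ (b ∷ v) h with h zero
... | refl = isAll⁺ v (h ∘ suc)

Bool-ext : ∀ {a b : Bool} → (a ≡ true → b ≡ true) → (b ≡ true → a ≡ true) → a ≡ b
Bool-ext {true} {true} f g = refl
Bool-ext {true} {false} f g = sym (f refl)
Bool-ext {false} {true} f g = g refl
Bool-ext {false} {false} f g = refl

isAll-permute : ∀ {m m′} (π : Fin m ↔ Fin m′) (Y : Vec Bool m′) → isAll (permute π Y) ≡ isAll Y
isAll-permute π Y = Bool-ext
  (λ a → isAll⁺ Y (λ k → trans (cong (lookup Y) (sym (to∘from π k)))
           (trans (sym (VecP.lookup∘tabulate (λ i → lookup Y (to π i)) (from π k))) (isAll⁻ (permute π Y) a (from π k)))))
  (λ a → isAll⁺ (permute π Y) (λ k → trans (VecP.lookup∘tabulate (λ i → lookup Y (to π i)) k) (isAll⁻ Y a (to π k))))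

count≤ : ∀ {m} (v : Vec Bool m) → count (lookup v) ≤ m
count≤ [] = z≤n
count≤ (true ∷ v) = s≤s (count≤ v)
count≤ (false ∷ v) = ℕP.m≤n⇒m≤1+n (count≤ v)

count< : ∀ {m} (v : Vec Bool m) → isAll v ≡ false → suc (count (lookup v)) ≤ m
count< (true ∷ v) na = s≤s (count< v na)
count< (false ∷ v) na = s≤s (count≤ v)

-- The subset of Fin m picked by w among the members of u, listed in increasing order.
within : ∀ {m} (u : Vec Bool m) → Vec Bool (count (lookup u)) → Vec Bool m
within [] w = []
within (true ∷ u) (b ∷ w) = b ∷ within u w
within (false ∷ u) w = false ∷ within u w

within-emb : ∀ {m} (u : Vec Bool m) w j → lookup (within u w) (emb (lookup u) j) ≡ lookup w j
within-emb (true ∷ u) (b ∷ w) zero = refl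
within-emb (true ∷ u) (b ∷ w) (suc j) = within-emb u w j
within-emb (false ∷ u) w j = within-emb u w j

within-⊆ : ∀ {m} (u : Vec Bool m) w k → lookup (within u w) k ≡ true → lookup u k ≡ true
within-⊆ (true ∷ u) (b ∷ w) zero eq = refl
within-⊆ (true ∷ u) (b ∷ w) (suc k) eq = within-⊆ u w k eq
within-⊆ (false ∷ u) w zero ()
within-⊆ (false ∷ u) w (suc k) eq = within-⊆ u w k eq

-- A splitting of the points into three parts, read as "parts 1,2 versus 3, then 1 versus 2"
-- (in₁₂, in₁-of-₁₂) and as "part 1 versus 2,3, then 2 versus 3" (in₁, in₂-of-₂₃).
data Part : Set where
  first second third : Part

in₁₂ : ∀ {m} → Vec Part m → Vec Bool m
in₁₂ [] = []
in₁₂ (first ∷ z) = true ∷ in₁₂ z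
in₁₂ (second ∷ z) = true ∷ in₁₂ z
in₁₂ (third ∷ z) = false ∷ in₁₂ z

in₁-of-₁₂ : ∀ {m} (z : Vec Part m) → Vec Bool (count (lookup (in₁₂ z)))
in₁-of-₁₂ [] = []
in₁-of-₁₂ (first ∷ z) = true ∷ in₁-of-₁₂ z
in₁-of-₁₂ (second ∷ z) = false ∷ in₁-of-₁₂ z
in₁-of-₁₂ (third ∷ z) = in₁-of-₁₂ z

in₁ : ∀ {m} → Vec Part m → Vec Bool m
in₁ [] = []
in₁ (first ∷ z) = true ∷ in₁ z
in₁ (second ∷ z) = false ∷ in₁ z
in₁ (third ∷ z) = false ∷ in₁ z

in₂-of-₂₃ : ∀ {m} (z : Vec Part m) → Vec Bool (count (lookup (Vec.map not (in₁ z))))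
in₂-of-₂₃ [] = []
in₂-of-₂₃ (first ∷ z) = in₂-of-₂₃ z
in₂-of-₂₃ (second ∷ z) = true ∷ in₂-of-₂₃ z
in₂-of-₂₃ (third ∷ z) = false ∷ in₂-of-₂₃ z

within-part₁ : ∀ {m} (z : Vec Part m) → within (in₁₂ z) (in₁-of-₁₂ z) ≡ in₁ z
within-part₁ [] = refl
within-part₁ (first ∷ z) = cong (true ∷_) (within-part₁ z)
within-part₁ (second ∷ z) = cong (false ∷_) (within-part₁ z)
within-part₁ (third ∷ z) = cong (false ∷_) (within-part₁ z)

within-part₂ : ∀ {m} (z : Vec Part m) → within (in₁₂ z) (Vec.map not (in₁-of-₁₂ z)) ≡ within (Vec.map not (in₁ z)) (in₂-of-₂₃ z)
within-part₂ [] = refl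
within-part₂ (first ∷ z) = cong (false ∷_) (within-part₂ z)
within-part₂ (second ∷ z) = cong (true ∷_) (within-part₂ z)
within-part₂ (third ∷ z) = cong (false ∷_) (within-part₂ z)

within-part₃ : ∀ {m} (z : Vec Part m) → Vec.map not (in₁₂ z) ≡ within (Vec.map not (in₁ z)) (Vec.map not (in₂-of-₂₃ z))
within-part₃ [] = refl
within-part₃ (first ∷ z) = cong (false ∷_) (within-part₃ z)
within-part₃ (second ∷ z) = cong (false ∷_) (within-part₃ z)
within-part₃ (third ∷ z) = cong (true ∷_) (within-part₃ z)

module LinearCombinations {c ℓ} (K : Field c ℓ) where
  module K = Field K
  open K using (Carrier; _≈_; _*_; -_; 0#; 1#) renaming (_+_ to _+K_)
  open FreeVS K

  ∑ : ∀ {b} {B : Set b} n → (Vec Bool n → FV B) → FV B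
  ∑ zero    h = h []
  ∑ (suc n) h = ∑ n (λ v → h (true ∷ v) ++ h (false ∷ v))

  ∑₃ : ∀ {b} {B : Set b} n → (Vec Part n → FV B) → FV B
  ∑₃ zero h = h []
  ∑₃ (suc n) h = ∑₃ n (λ z → (h (first ∷ z) ++ h (second ∷ z)) ++ h (third ∷ z))

  dropIf : ∀ {b} {B : Set b} → Bool → FV B → FV B
  dropIf true  _  = []
  dropIf false xs = xs

  AllB-++ : ∀ {a p} {B : Set a} {P : B → Set p} xs ys → AllB P xs → AllB P ys → AllB P (xs ++ ys)
  AllB-++ []       ys _        q = q
  AllB-++ (x ∷ xs) ys (p , ps) q = p , AllB-++ xs ys ps q

  AllB-scale : ∀ {a p} {B : Set a} {P : B → Set p} s xs → AllB P xs → AllB P (scale s xs)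
  AllB-scale s []       _        = _
  AllB-scale s (x ∷ xs) (p , ps) = p , AllB-scale s xs ps

  AllB-lin : ∀ {a b p q} {A : Set a} {B : Set b} {P : A → Set p} {Q : B → Set q} (f : A → FV B) xs →
             AllB P xs → (∀ x → P x → AllB Q (f x)) → AllB Q (lin f xs)
  AllB-lin f []             _        h = _
  AllB-lin f ((s , x) ∷ xs) (p , ps) h =
    AllB-++ (scale s (f x)) _ (AllB-scale s (f x) (h x p)) (AllB-lin f xs ps h)

  AllB-∑ : ∀ {a p} {B : Set a} {P : B → Set p} m (h : Vec Bool m → FV B) →
           (∀ v → AllB P (h v)) → AllB P (∑ m h)
  AllB-∑ zero    h a = a []
  AllB-∑ (suc m) h a = AllB-∑ m _ (λ v → AllB-++ (h (true ∷ v)) _ (a (true ∷ v)) (a (false ∷ v)))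

  AllB-⊤ : ∀ {a} {A : Set a} (xs : FV A) → AllB (λ _ → ⊤) xs
  AllB-⊤ []       = _
  AllB-⊤ (x ∷ xs) = _ , AllB-⊤ xs

  linK-++ : ∀ {a} {A : Set a} (g : A → Carrier) xs ys → linK g (xs ++ ys) ≈ linK g xs +K linK g ys
  linK-++ g []             ys = K.sym (K.+-identityˡ _)
  linK-++ g ((a , x) ∷ xs) ys = K.trans (K.+-congˡ (linK-++ g xs ys)) (K.sym (K.+-assoc _ _ _))

  linK-scale : ∀ {a} {A : Set a} (g : A → Carrier) t xs → linK g (scale t xs) ≈ t * linK g xs
  linK-scale g t []             = K.sym (K.zeroʳ t)
  linK-scale g t ((a , x) ∷ xs) =
    K.trans (K.+-cong (K.*-assoc t a (g x)) (linK-scale g t xs)) (K.sym (K.distribˡ t _ _))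

  linK-lin : ∀ {a b} {A : Set a} {B : Set b} (g : B → Carrier) (f : A → FV B) xs →
             linK g (lin f xs) ≈ linK (λ x → linK g (f x)) xs
  linK-lin g f []             = K.refl
  linK-lin g f ((a , x) ∷ xs) =
    K.trans (linK-++ g (scale a (f x)) _) (K.+-cong (linK-scale g a (f x)) (linK-lin g f xs))

  linK-cong : ∀ {a r} {A : Set a} {R : A → A → Set r} (g : A → Carrier) →
              (∀ {x y} → R x y → g x ≈ g y) → ∀ {xs ys} → Eqv R xs ys → linK g xs ≈ linK g ys
  linK-cong g gc e-refl         = K.refl
  linK-cong g gc (e-sym p)      = K.sym (linK-cong g gc p)
  linK-cong g gc (e-trans p q)  = K.trans (linK-cong g gc p) (linK-cong g gc q)
  linK-cong g gc (e-cons p q r) = K.+-cong (K.*-cong p (gc q)) (linK-cong g gc r)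
  linK-cong g gc e-swap  =
    K.trans (K.sym (K.+-assoc _ _ _)) (K.trans (K.+-congʳ (K.+-comm _ _)) (K.+-assoc _ _ _))
  linK-cong g gc e-zero  = K.trans (K.+-congʳ (K.zeroˡ _)) (K.+-identityˡ _)
  linK-cong g gc e-merge = K.trans (K.sym (K.+-assoc _ _ _)) (K.+-congʳ (K.sym (K.distribʳ _ _ _)))

  linK-congᶠ : ∀ {a} {A : Set a} (f g : A → Carrier) xs → (∀ x → f x ≈ g x) → linK f xs ≈ linK g xs
  linK-congᶠ f g []             h = K.refl
  linK-congᶠ f g ((a , x) ∷ xs) h = K.+-cong (K.*-congˡ (h x)) (linK-congᶠ f g xs h)

  linK-*ˡ : ∀ {a} {A : Set a} t (g : A → Carrier) xs → linK (λ x → t * g x) xs ≈ t * linK g xs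
  linK-*ˡ t g []             = K.sym (K.zeroʳ t)
  linK-*ˡ t g ((a , x) ∷ xs) =
    K.trans (K.+-cong (K.trans (K.sym (K.*-assoc a t (g x)))
                      (K.trans (K.*-congʳ (K.*-comm a t)) (K.*-assoc t a (g x)))) (linK-*ˡ t g xs))
            (K.sym (K.distribˡ t _ _))

  linK-*ʳ : ∀ {a} {A : Set a} t (g : A → Carrier) xs → linK (λ x → g x * t) xs ≈ linK g xs * t
  linK-*ʳ t g xs = K.trans (linK-congᶠ _ _ xs (λ x → K.*-comm (g x) t))
                           (K.trans (linK-*ˡ t g xs) (K.*-comm t _))

  single-cong : ∀ {a r} {B : Set a} {R : B → B → Set r} {x b b′} → R b b′ → Eqv R ((x , b) ∷ []) ((x , b′) ∷ [])
  single-cong p = e-cons K.refl p e-refl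

  module EqvProperties {a r} {B : Set a} (R : B → B → Set r) (R-refl : ∀ b → R b b) where
    infix 4 _≋_
    _≋_ : FV B → FV B → Set (c ⊔ ℓ ⊔ a ⊔ r)
    _≋_ = Eqv R

    ≋-setoid : Setoid (c ⊔ a) (c ⊔ ℓ ⊔ a ⊔ r)
    ≋-setoid = record
      { Carrier = FV B ; _≈_ = _≋_ ; isEquivalence = record { refl = e-refl ; sym = e-sym ; trans = e-trans } }

    module ≋-Reasoning = SetoidReasoning ≋-setoid

    ≡⇒≋ : ∀ {x y} → x ≡ y → x ≋ y
    ≡⇒≋ refl = e-refl

    cons-coef : ∀ {a a′ b xs ys} → a ≈ a′ → xs ≋ ys → ((a , b) ∷ xs) ≋ ((a′ , b) ∷ ys)
    cons-coef {b = b} p q = e-cons p (R-refl b) q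

    cons⁺ : ∀ {p xs ys} → xs ≋ ys → (p ∷ xs) ≋ (p ∷ ys)
    cons⁺ {p = a , b} q = e-cons K.refl (R-refl b) q

    kill : ∀ {a b} → a ≈ 0# → ((a , b) ∷ []) ≋ []
    kill p = e-trans (cons-coef p e-refl) e-zero

    ++⁺ʳ : ∀ {xs ys} zs → xs ≋ ys → (xs ++ zs) ≋ (ys ++ zs)
    ++⁺ʳ zs e-refl         = e-refl
    ++⁺ʳ zs (e-sym p)      = e-sym (++⁺ʳ zs p)
    ++⁺ʳ zs (e-trans p q)  = e-trans (++⁺ʳ zs p) (++⁺ʳ zs q)
    ++⁺ʳ zs (e-cons x y p) = e-cons x y (++⁺ʳ zs p)
    ++⁺ʳ zs e-swap         = e-swap
    ++⁺ʳ zs e-zero         = e-zero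
    ++⁺ʳ zs e-merge        = e-merge

    ++⁺ˡ : ∀ xs {ys zs} → ys ≋ zs → (xs ++ ys) ≋ (xs ++ zs)
    ++⁺ˡ []       p = p
    ++⁺ˡ (x ∷ xs) p = cons⁺ (++⁺ˡ xs p)

    ++⁺ : ∀ {xs xs′ ys ys′} → xs ≋ xs′ → ys ≋ ys′ → (xs ++ ys) ≋ (xs′ ++ ys′)
    ++⁺ {xs′ = xs′} {ys = ys} p q = e-trans (++⁺ʳ ys p) (++⁺ˡ xs′ q)

    ++-assoc : ∀ xs ys zs → ((xs ++ ys) ++ zs) ≋ (xs ++ (ys ++ zs))
    ++-assoc xs ys zs = ≡⇒≋ (ListP.++-assoc xs ys zs)

    shift : ∀ xs p ys → (xs ++ p ∷ ys) ≋ (p ∷ xs ++ ys)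
    shift []       p ys = e-refl
    shift (x ∷ xs) p ys = e-trans (cons⁺ (shift xs p ys)) e-swap

    ++-comm : ∀ xs ys → (xs ++ ys) ≋ (ys ++ xs)
    ++-comm []       ys = ≡⇒≋ (sym (ListP.++-identityʳ ys))
    ++-comm (x ∷ xs) ys = e-trans (cons⁺ (++-comm xs ys)) (e-sym (shift ys x xs))

    ++-interchange : ∀ a b c d → ((a ++ b) ++ (c ++ d)) ≋ ((a ++ c) ++ (b ++ d))
    ++-interchange a b c d =
      e-trans (++-assoc a b (c ++ d))
      (e-trans (++⁺ˡ a (e-trans (e-sym (++-assoc b c d)) (e-trans (++⁺ʳ d (++-comm b c)) (++-assoc c b d))))
               (e-sym (++-assoc a c (b ++ d))))

    scale-cong : ∀ a {xs ys} → xs ≋ ys → scale a xs ≋ scale a ys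
    scale-cong a e-refl         = e-refl
    scale-cong a (e-sym p)      = e-sym (scale-cong a p)
    scale-cong a (e-trans p q)  = e-trans (scale-cong a p) (scale-cong a q)
    scale-cong a (e-cons x y p) = e-cons (K.*-congˡ x) y (scale-cong a p)
    scale-cong a e-swap         = e-swap
    scale-cong a e-zero         = e-trans (cons-coef (K.zeroʳ a) e-refl) e-zero
    scale-cong a e-merge        = e-trans e-merge (cons-coef (K.sym (K.distribˡ a _ _)) e-refl)

    scale-coef-cong : ∀ {a a′} → a ≈ a′ → ∀ xs → scale a xs ≋ scale a′ xs
    scale-coef-cong p []       = e-refl
    scale-coef-cong p (x ∷ xs) = cons-coef (K.*-congʳ p) (scale-coef-cong p xs)

    scale-scale : ∀ a a′ xs → scale a (scale a′ xs) ≋ scale (a * a′) xs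
    scale-scale a a′ []       = e-refl
    scale-scale a a′ (x ∷ xs) = cons-coef (K.sym (K.*-assoc a a′ _)) (scale-scale a a′ xs)

    scale-identity : ∀ xs → scale 1# xs ≋ xs
    scale-identity []       = e-refl
    scale-identity (x ∷ xs) = cons-coef (K.*-identityˡ _) (scale-identity xs)

    scale-zero : ∀ xs → scale 0# xs ≋ []
    scale-zero []       = e-refl
    scale-zero (x ∷ xs) = e-trans (cons-coef (K.zeroˡ _) (scale-zero xs)) e-zero

    scale-distrib-+ : ∀ a a′ xs → scale (a +K a′) xs ≋ (scale a xs ++ scale a′ xs)
    scale-distrib-+ a a′ []             = e-refl
    scale-distrib-+ a a′ ((x , b) ∷ xs) =
      e-trans (cons-coef (K.distribʳ x a a′) (scale-distrib-+ a a′ xs))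
      (e-trans (e-sym e-merge) (cons⁺ (e-sym (shift (scale a xs) _ (scale a′ xs)))))

    neg : FV B → FV B
    neg = scale (- 1#)

    neg-inverse : ∀ xs → (xs ++ neg xs) ≋ []
    neg-inverse xs =
      e-trans (++⁺ (e-sym (scale-identity xs)) e-refl)
      (e-trans (e-sym (scale-distrib-+ 1# (- 1#) xs))
      (e-trans (scale-coef-cong (K.-‿inverseʳ 1#) xs) (scale-zero xs)))

    lin-++ : ∀ {a} {A : Set a} (f : A → FV B) xs ys → lin f (xs ++ ys) ≡ lin f xs ++ lin f ys
    lin-++ f xs ys = ListP.concatMap-++ _ xs ys

    lin-basis : ∀ {a} {A : Set a} (f : A → FV B) x → lin f ((1# , x) ∷ []) ≋ f x
    lin-basis f x = e-trans (≡⇒≋ (ListP.++-identityʳ _)) (scale-identity (f x))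

    lin-scale : ∀ {a} {A : Set a} (f : A → FV B) t xs → lin f (scale t xs) ≋ scale t (lin f xs)
    lin-scale f t []             = e-refl
    lin-scale f t ((a , x) ∷ xs) =
      e-trans (++⁺ (e-sym (scale-scale t a (f x))) (lin-scale f t xs))
              (≡⇒≋ (sym (ListP.map-++ _ (scale a (f x)) (lin f xs))))

    lin-cong : ∀ {a r} {A : Set a} {R′ : A → A → Set r} (f : A → FV B) →
               (∀ {x y} → R′ x y → f x ≋ f y) → ∀ {xs ys} → Eqv R′ xs ys → lin f xs ≋ lin f ys
    lin-cong f fc e-refl        = e-refl
    lin-cong f fc (e-sym p)     = e-sym (lin-cong f fc p)
    lin-cong f fc (e-trans p q) = e-trans (lin-cong f fc p) (lin-cong f fc q)
    lin-cong f fc (e-cons {a′ = a′} p q rest) =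
      ++⁺ (e-trans (scale-coef-cong p _) (scale-cong a′ (fc q))) (lin-cong f fc rest)
    lin-cong f fc (e-swap {p = a , x} {q = a′ , y} {xs = xs}) =
      e-trans (e-sym (++-assoc (scale a (f x)) (scale a′ (f y)) (lin f xs)))
      (e-trans (++⁺ʳ (lin f xs) (++-comm (scale a (f x)) (scale a′ (f y))))
               (++-assoc (scale a′ (f y)) (scale a (f x)) (lin f xs)))
    lin-cong f fc (e-zero {b = x}) = ++⁺ʳ _ (scale-zero (f x))
    lin-cong f fc (e-merge {a = a} {a′ = a′} {b = x}) =
      e-trans (e-sym (++-assoc (scale a (f x)) _ _)) (++⁺ʳ _ (e-sym (scale-distrib-+ a a′ (f x))))

    lin-congᶠ-on : ∀ {a p} {A : Set a} {P : A → Set p} (f g : A → FV B) xs → AllB P xs →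
                   (∀ x → P x → f x ≋ g x) → lin f xs ≋ lin g xs
    lin-congᶠ-on f g []             _        h = e-refl
    lin-congᶠ-on f g ((a , x) ∷ xs) (p , ps) h = ++⁺ (scale-cong a (h x p)) (lin-congᶠ-on f g xs ps h)

    lin-congᶠ : ∀ {a} {A : Set a} (f g : A → FV B) xs → (∀ x → f x ≋ g x) → lin f xs ≋ lin g xs
    lin-congᶠ f g xs h = lin-congᶠ-on f g xs (AllB-⊤ xs) (λ x _ → h x)

    lin-++ᶠ : ∀ {a} {A : Set a} (f g : A → FV B) xs → lin (λ x → f x ++ g x) xs ≋ (lin f xs ++ lin g xs)
    lin-++ᶠ f g []             = e-refl
    lin-++ᶠ f g ((a , x) ∷ xs) =
      e-trans (++⁺ (≡⇒≋ (ListP.map-++ _ (f x) (g x))) (lin-++ᶠ f g xs))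
              (++-interchange (scale a (f x)) (scale a (g x)) (lin f xs) (lin g xs))

    lin-zero : ∀ {a} {A : Set a} (xs : FV A) → lin (λ _ → []) xs ≋ []
    lin-zero []       = e-refl
    lin-zero (x ∷ xs) = lin-zero xs

    lin-scaleᶠ : ∀ {a} {A : Set a} (f : A → FV B) t xs → lin (λ x → scale t (f x)) xs ≋ scale t (lin f xs)
    lin-scaleᶠ f t []             = e-refl
    lin-scaleᶠ f t ((a , x) ∷ xs) =
      e-trans (++⁺ (e-trans (scale-scale a t (f x))
                   (e-trans (scale-coef-cong (K.*-comm a t) (f x)) (e-sym (scale-scale t a (f x)))))
                   (lin-scaleᶠ f t xs))
              (≡⇒≋ (sym (ListP.map-++ _ (scale a (f x)) (lin f xs))))

    lin-∘ : ∀ {a a′} {A : Set a} {A′ : Set a′} (f : A → FV A′) (g : A′ → FV B) xs →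
            lin g (lin f xs) ≋ lin (λ x → lin g (f x)) xs
    lin-∘ f g []             = e-refl
    lin-∘ f g ((a , x) ∷ xs) =
      e-trans (≡⇒≋ (lin-++ g (scale a (f x)) (lin f xs))) (++⁺ (lin-scale g a (f x)) (lin-∘ f g xs))

    lin-comm : ∀ {a a′} {A : Set a} {A′ : Set a′} (h : A → A′ → FV B) xs ys →
               lin (λ x → lin (λ y → h x y) ys) xs ≋ lin (λ y → lin (λ x → h x y) xs) ys
    lin-comm h []             ys = e-sym (lin-zero ys)
    lin-comm h ((t , x) ∷ xs) ys =
      e-trans (++⁺ (e-sym (lin-scaleᶠ (h x) t ys)) (lin-comm h xs ys))
              (e-sym (lin-++ᶠ (λ y → scale t (h x y)) (λ y → lin (λ x → h x y) xs) ys))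

    lin-identity : ∀ xs → lin (λ x → (1# , x) ∷ []) xs ≋ xs
    lin-identity []             = e-refl
    lin-identity ((a , x) ∷ xs) = cons-coef (K.*-identityʳ a) (lin-identity xs)

    lin-collect : ∀ {a} {A : Set a} (g : A → Carrier) (b₀ : B) xs →
                  lin (λ x → (g x , b₀) ∷ []) xs ≋ ((linK g xs , b₀) ∷ [])
    lin-collect g b₀ []             = e-sym e-zero
    lin-collect g b₀ ((a , x) ∷ xs) = e-trans (cons⁺ (lin-collect g b₀ xs)) e-merge

    ∑-≡ : ∀ n {h g : Vec Bool n → FV B} → (∀ v → h v ≡ g v) → ∑ n h ≋ ∑ n g
    ∑-≡ zero    p = ≡⇒≋ (p [])
    ∑-≡ (suc n) p = ∑-≡ n (λ v → cong₂ _++_ (p (true ∷ v)) (p (false ∷ v)))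

    lin-∑ : ∀ {a} {A : Set a} (f : A → FV B) n (h : Vec Bool n → FV A) →
            lin f (∑ n h) ≋ ∑ n (λ v → lin f (h v))
    lin-∑ f zero    h = e-refl
    lin-∑ f (suc n) h =
      e-trans (lin-∑ f n (λ v → h (true ∷ v) ++ h (false ∷ v)))
              (∑-≡ n (λ v → lin-++ f (h (true ∷ v)) (h (false ∷ v))))

    ∑-cong : ∀ n {h g : Vec Bool n → FV B} → (∀ v → h v ≋ g v) → ∑ n h ≋ ∑ n g
    ∑-cong zero    p = p []
    ∑-cong (suc n) p = ∑-cong n (λ v → ++⁺ (p (true ∷ v)) (p (false ∷ v)))

    lin-∑-basis : ∀ {a} {A : Set a} (f : A → FV B) n (g : Vec Bool n → A) →
                  lin f (∑ n (λ v → (1# , g v) ∷ [])) ≋ ∑ n (λ v → f (g v))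
    lin-∑-basis f n g = e-trans (lin-∑ f n _) (∑-cong n (λ v → lin-basis f (g v)))

    bilin-∑ : ∀ {a a′} {A : Set a} {A′ : Set a′} (f : A → A′ → FV B) m n
                (g : Vec Bool m → A) (h : Vec Bool n → A′) →
              bilin f (∑ m (λ v → (1# , g v) ∷ [])) (∑ n (λ w → (1# , h w) ∷ []))
              ≋ ∑ m (λ v → ∑ n (λ w → f (g v) (h w)))
    bilin-∑ f m n g h =
      e-trans (lin-∑-basis (λ x → lin (f x) (∑ n (λ w → (1# , h w) ∷ []))) m g)
              (∑-cong m (λ v → lin-∑-basis (f (g v)) n h))

    ∑-++ : ∀ n (h g : Vec Bool n → FV B) → ∑ n (λ v → h v ++ g v) ≋ (∑ n h ++ ∑ n g)
    ∑-++ zero    h g = e-refl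
    ∑-++ (suc n) h g =
      e-trans (∑-cong n (λ v → ++-interchange (h (true ∷ v)) (g (true ∷ v)) (h (false ∷ v)) (g (false ∷ v))))
              (∑-++ n (λ v → h (true ∷ v) ++ h (false ∷ v)) (λ v → g (true ∷ v) ++ g (false ∷ v)))

    ∑-split : ∀ m n (h : Vec Bool (m + n) → FV B) →
              ∑ (m + n) h ≋ ∑ m (λ v → ∑ n (λ w → h (v Vec.++ w)))
    ∑-split zero    n h = e-refl
    ∑-split (suc m) n h =
      e-trans (∑-split m n (λ u → h (true ∷ u) ++ h (false ∷ u)))
              (∑-cong m (λ v → ∑-++ n (λ w → h (true ∷ (v Vec.++ w))) (λ w → h (false ∷ (v Vec.++ w)))))

    ∑-split-all : ∀ m (h : Vec Bool m → FV B) →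
            ∑ m h ≋ (∑ m (λ v → dropIf (isAll v) (h v)) ++ h (replicate m true))
    ∑-split-all zero h = e-refl
    ∑-split-all (suc m) h =
      e-trans (∑-++ m (λ v → h (true ∷ v)) (λ v → h (false ∷ v)))
      (e-trans (++⁺ʳ (∑ m (λ v → h (false ∷ v))) (∑-split-all m (λ v → h (true ∷ v))))
      (e-trans (++-assoc (∑ m (λ v → dropIf (isAll v) (h (true ∷ v)))) (h (true ∷ replicate m true)) _)
      (e-trans (++⁺ˡ (∑ m (λ v → dropIf (isAll v) (h (true ∷ v)))) (++-comm (h (true ∷ replicate m true)) _))
      (e-trans (e-sym (++-assoc (∑ m (λ v → dropIf (isAll v) (h (true ∷ v)))) _ (h (true ∷ replicate m true))))
      (++⁺ʳ (h (true ∷ replicate m true))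
         (e-sym (∑-++ m (λ v → dropIf (isAll v) (h (true ∷ v))) (λ v → h (false ∷ v)))))))))

    ∑-single : ∀ n (h : Vec Bool n → FV B) v₀ → (∀ v → v ≢ v₀ → h v ≋ []) → ∑ n h ≋ h v₀
    ∑-single zero    h [] z = e-refl
    ∑-single (suc n) h (true ∷ v₀) z =
      e-trans (∑-cong n (λ v → e-trans (++⁺ e-refl (z (false ∷ v) (λ ()))) (≡⇒≋ (ListP.++-identityʳ _))))
              (∑-single n (λ v → h (true ∷ v)) v₀ (λ v ne → z (true ∷ v) (ne ∘ VecP.∷-injectiveʳ)))
    ∑-single (suc n) h (false ∷ v₀) z =
      e-trans (∑-cong n (λ v → ++⁺ (z (true ∷ v) (λ ())) e-refl))
              (∑-single n (λ v → h (false ∷ v)) v₀ (λ v ne → z (false ∷ v) (ne ∘ VecP.∷-injectiveʳ)))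

    ∑-not : ∀ n (h : Vec Bool n → FV B) → ∑ n h ≋ ∑ n (λ v → h (Vec.map not v))
    ∑-not zero    h = e-refl
    ∑-not (suc n) h =
      e-trans (∑-not n (λ v → h (true ∷ v) ++ h (false ∷ v)))
              (∑-cong n (λ v → ++-comm (h (true ∷ Vec.map not v)) (h (false ∷ Vec.map not v))))

    ∑-insertAt : ∀ n (h : Vec Bool (suc n) → FV B) p →
                 ∑ (suc n) h ≋ ∑ n (λ v → h (insertAt v p true) ++ h (insertAt v p false))
    ∑-insertAt n       h zero    = e-refl
    ∑-insertAt (suc n) h (suc p) =
      e-trans (∑-insertAt n (λ v → h (true ∷ v) ++ h (false ∷ v)) p)
              (∑-cong n (λ v → ++-interchange (h (true ∷ insertAt v p true)) (h (false ∷ insertAt v p true))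
                                              (h (true ∷ insertAt v p false)) (h (false ∷ insertAt v p false))))

    ∑-permute : ∀ m n (π : Permutation m n) (h : Vec Bool m → FV B) → ∑ m h ≋ ∑ n (λ v → h (permute π v))
    ∑-permute zero    zero    π h = e-refl
    ∑-permute zero    (suc n) π h with π ⟨$⟩ˡ zero
    ... | ()
    ∑-permute (suc m) zero    π h with π ⟨$⟩ʳ zero
    ... | ()
    ∑-permute (suc m) (suc n) π h =
      e-trans (∑-permute m n (remove zero π) (λ v → h (true ∷ v) ++ h (false ∷ v)))
      (e-trans (∑-cong n (λ v → ≡⇒≋ (sym (cong₂ _++_ (cong h (permute-insertAt π v true))
                                                     (cong h (permute-insertAt π v false))))))
               (e-sym (∑-insertAt n (λ v → h (permute π v)) (π ⟨$⟩ʳ zero))))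

    concat-subsets : ∀ n (g : (Fin n → Bool) → FV B) → (∀ f f′ → (∀ k → f k ≡ f′ k) → g f ≋ g f′) →
                     concat (map g (subsets n)) ≋ ∑ n (λ v → g (lookup v))
    concat-subsets zero    g g-ext = e-trans (≡⇒≋ (ListP.++-identityʳ _)) (g-ext _ _ (λ ()))
    concat-subsets (suc n) g g-ext =
      e-trans (≡⇒≋ (unfold (subsets n)))
      (e-trans (concat-subsets n g′ (λ f f′ h → ++⁺ (g-ext _ _ (consB-ext true h)) (g-ext _ _ (consB-ext false h))))
               (∑-cong n (λ v → ++⁺ (g-ext _ _ (consB-lookup true v)) (g-ext _ _ (consB-lookup false v)))))
      where
      g′ : (Fin n → Bool) → FV B
      g′ f = g (consB true f) ++ g (consB false f)
      unfold : ∀ L → concat (map g (concatMap (λ f → consB true f ∷ consB false f ∷ []) L)) ≡ concat (map g′ L)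
      unfold []      = refl
      unfold (f ∷ L) = trans (sym (ListP.++-assoc (g (consB true f)) (g (consB false f)) _)) (cong (g′ f ++_) (unfold L))
      consB-ext : ∀ b {f f′ : Fin n → Bool} → (∀ k → f k ≡ f′ k) → ∀ k → consB b f k ≡ consB b f′ k
      consB-ext b h zero    = refl
      consB-ext b h (suc k) = h k
      consB-lookup : ∀ b (v : Vec Bool n) k → consB b (lookup v) k ≡ lookup (b ∷ v) k
      consB-lookup b v zero    = refl
      consB-lookup b v (suc k) = refl

    ∑₃-cong : ∀ m {h g : Vec Part m → FV B} → (∀ z → h z ≋ g z) → ∑₃ m h ≋ ∑₃ m g
    ∑₃-cong zero    p = p []
    ∑₃-cong (suc m) p = ∑₃-cong m (λ z → ++⁺ (++⁺ (p (first ∷ z)) (p (second ∷ z))) (p (third ∷ z)))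

    ∑∑≈∑₃ˡ : ∀ m (F : (v : Vec Bool m) → Vec Bool (count (lookup v)) → FV B) →
             ∑ m (λ v → ∑ (count (lookup v)) (F v)) ≋ ∑₃ m (λ z → F (in₁₂ z) (in₁-of-₁₂ z))
    ∑∑≈∑₃ˡ zero    F = e-refl
    ∑∑≈∑₃ˡ (suc m) F =
      e-trans (∑-cong m (λ v → e-sym (∑-++ (count (lookup v))
                 (λ w → F (true ∷ v) (true ∷ w) ++ F (true ∷ v) (false ∷ w)) (F (false ∷ v)))))
              (∑∑≈∑₃ˡ m (λ v w → (F (true ∷ v) (true ∷ w) ++ F (true ∷ v) (false ∷ w)) ++ F (false ∷ v) w))

    ∑∑≈∑₃ʳ : ∀ m (F : (v : Vec Bool m) → Vec Bool (count (lookup (Vec.map not v))) → FV B) →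
             ∑ m (λ v → ∑ (count (lookup (Vec.map not v))) (F v)) ≋ ∑₃ m (λ z → F (in₁ z) (in₂-of-₂₃ z))
    ∑∑≈∑₃ʳ zero    F = e-refl
    ∑∑≈∑₃ʳ (suc m) F =
      e-trans (∑-cong m (λ v → e-trans (e-sym (∑-++ (count (lookup (Vec.map not v)))
                 (F (true ∷ v)) (λ w → F (false ∷ v) (true ∷ w) ++ F (false ∷ v) (false ∷ w))))
                 (∑-cong _ (λ w → e-sym (++-assoc (F (true ∷ v) w) _ _)))))
              (∑∑≈∑₃ʳ m (λ v w → (F (true ∷ v) w ++ F (false ∷ v) (true ∷ w)) ++ F (false ∷ v) (false ∷ w)))

Image : ∀ {m N} → (Fin m → Fin N) → Fin N → Set
Image {m} e k = Σ (Fin m) λ j → e j ≡ k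

sameImage⇒↔ : ∀ {m m′ N} (e : Fin m → Fin N) (e′ : Fin m′ → Fin N) →
              Injective _≡_ _≡_ e → Injective _≡_ _≡_ e′ →
              (∀ j → Image e′ (e j)) → (∀ j → Image e (e′ j)) →
              Σ (Fin m ↔ Fin m′) λ σ → ∀ j → e′ (to σ j) ≡ e j
sameImage⇒↔ e e′ e-inj e′-inj h h′ =
  mk↔ₛ′ (λ j → proj₁ (h j)) (λ j → proj₁ (h′ j))
    (λ y → e′-inj (trans (proj₂ (h (proj₁ (h′ y)))) (proj₂ (h′ y))))
    (λ x → e-inj (trans (proj₂ (h′ (proj₁ (h x)))) (proj₂ (h x)))) ,
  λ j → proj₂ (h j)

embB-injective : ∀ {m n} b (f : Fin m → Fin n) → Injective _≡_ _≡_ f → Injective _≡_ _≡_ (embB b f)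
embB-injective true  f f-inj {zero}  {zero}  eq = refl
embB-injective true  f f-inj {suc x} {suc y} eq = cong suc (f-inj (FinP.suc-injective eq))
embB-injective false f f-inj eq = f-inj (FinP.suc-injective eq)

emb-injective : ∀ {n} (p : Fin n → Bool) → Injective _≡_ _≡_ (emb p)
emb-injective {suc n} p = embB-injective (p zero) _ (emb-injective (p ∘ suc))

embB-elim : ∀ {m n} b (f : Fin m → Fin n) (Q : Fin (suc n) → Set) →
            (b ≡ true → Q zero) → (∀ j → Q (suc (f j))) → ∀ j → Q (embB b f j)
embB-elim true  f Q z s zero    = z refl
embB-elim true  f Q z s (suc j) = s j
embB-elim false f Q z s j       = s j

emb-member : ∀ {n} (p : Fin n → Bool) j → p (emb p j) ≡ true
emb-member {suc n} p = embB-elim (p zero) _ (λ k → p k ≡ true) id (emb-member (p ∘ suc))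

emb-onto : ∀ {n} (p : Fin n → Bool) k → p k ≡ true → Image (emb p) k
emb-onto {suc n} p zero    eq with p zero
... | true = zero , refl
emb-onto {suc n} p (suc k) eq with emb-onto (p ∘ suc) k eq
... | j , refl with p zero
... | true  = suc j , refl
... | false = j , refl

emb-image : ∀ {n} (p : Fin n → Bool) k → Image (emb p) k → p k ≡ true
emb-image p k (j , refl) = emb-member p j

and-tabulate⁻ : ∀ {n} (g : Fin n → Bool) → and (List.tabulate g) ≡ true → ∀ k → g k ≡ true
and-tabulate⁻ {suc n} g eq zero with g zero | eq
... | true | _ = refl
and-tabulate⁻ {suc n} g eq (suc k) with g zero | eq
... | true | eq′ = and-tabulate⁻ (g ∘ suc) eq′ k

and-tabulate⁺ : ∀ {n} (g : Fin n → Bool) → (∀ k → g k ≡ true) → and (List.tabulate g) ≡ true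
and-tabulate⁺ {zero}  g h = refl
and-tabulate⁺ {suc n} g h rewrite h zero = and-tabulate⁺ (g ∘ suc) (h ∘ suc)

suppIn-tabulate : ∀ {n} (a : Fin n → ℕ) X → suppIn a X ≡ and (List.tabulate (λ k → X k ∨ (a k ≡ᵇ 0)))
suppIn-tabulate a X = cong and (ListP.map-tabulate id (λ k → X k ∨ (a k ≡ᵇ 0)))

suppIn⁻ : ∀ {n} (a : Fin n → ℕ) X → suppIn a X ≡ true → ∀ k → ¬ a k ≡ 0 → X k ≡ true
suppIn⁻ a X eq k a≢0 with and-tabulate⁻ _ (trans (sym (suppIn-tabulate a X)) eq) k
... | h with X k
... | true  = refl
... | false with a k
... | zero  = ⊥-elim (a≢0 refl)
... | suc _ = h

suppIn⁺ : ∀ {n} (a : Fin n → ℕ) X → (∀ k → ¬ a k ≡ 0 → X k ≡ true) → suppIn a X ≡ true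
suppIn⁺ a X h = trans (suppIn-tabulate a X) (and-tabulate⁺ _ g)
  where
  g : ∀ k → (X k ∨ (a k ≡ᵇ 0)) ≡ true
  g k with a k ≟ℕ 0
  ... | yes z  rewrite z = BoolP.∨-zeroʳ (X k)
  ... | no a≢0 rewrite h k a≢0 = refl

MCIso-refl : ∀ C → MCIso C C
MCIso-refl C = record { σ = ↔-refl ; τ = ↔-refl ; A-pres = λ i k → refl ; le-pres = λ i j → refl }

MCIso-sym : ∀ {C D} → MCIso C D → MCIso D C
MCIso-sym {C} {D} φ = record
  { σ = ↔-sym σ ; τ = ↔-sym τ
  ; A-pres  = λ i k → trans (sym (A-pres (from τ i) (from σ k))) (cong₂ (A D) (to∘from τ i) (to∘from σ k))
  ; le-pres = λ i j → trans (sym (le-pres (from τ i) (from τ j))) (cong₂ (le D) (to∘from τ i) (to∘from τ j)) }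
  where open MCIso φ

MCIso-trans : ∀ {C D E} → MCIso C D → MCIso D E → MCIso C E
MCIso-trans φ ψ = record
  { σ = ↔-trans (MCIso.σ φ) (MCIso.σ ψ) ; τ = ↔-trans (MCIso.τ φ) (MCIso.τ ψ)
  ; A-pres  = λ i k → trans (MCIso.A-pres ψ _ _) (MCIso.A-pres φ i k)
  ; le-pres = λ i j → trans (MCIso.le-pres ψ _ _) (MCIso.le-pres φ i j) }

SupportIn : ∀ {N} → (Fin N → ℕ) → (Fin N → Set) → Set
SupportIn a P = ∀ k → ¬ (a k ≡ 0) → P k

restrictAlong : (C : MC) {m s : ℕ} → (Fin m → Fin (n C)) → (Fin s → Fin (r C)) → MC
restrictAlong C {m} {s} e f = mc m s (λ i k → A C (f i) (e k)) (λ i j → le C (f i) (f j))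

-- restrictAlong C e f is a presentation of C|_X for X the image of e.
record FullEmbedding (C : MC) {m s} (e : Fin m → Fin (n C)) (f : Fin s → Fin (r C)) : Set where
  field
    points-inj       : Injective _≡_ _≡_ e
    members-inj      : Injective _≡_ _≡_ f
    members-inside   : ∀ j → SupportIn (A C (f j)) (Image e)
    members-complete : ∀ i → SupportIn (A C i) (Image e) → Image f i

restrict-full : ∀ C X → FullEmbedding C (emb X) (emb (λ i → suppIn (A C i) X))
restrict-full C X = record
  { points-inj       = emb-injective X
  ; members-inj      = emb-injective keep
  ; members-inside   = λ j k a≢0 → emb-onto X k (suppIn⁻ (A C (emb keep j)) X (emb-member keep j) k a≢0)
  ; members-complete = λ i h → emb-onto keep i (suppIn⁺ (A C i) X (λ k a≢0 → emb-image X k (h k a≢0))) }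
  where
  keep : Fin (r C) → Bool
  keep i = suppIn (A C i) X

id-full : ∀ C → FullEmbedding C id id
id-full C = record
  { points-inj = id ; members-inj = id ; members-inside = λ j k _ → k , refl ; members-complete = λ i _ → i , refl }

∘-full : ∀ {C m s m′ s′} {e : Fin m → Fin (n C)} {f : Fin s → Fin (r C)}
         {e′ : Fin m′ → Fin m} {f′ : Fin s′ → Fin s} →
         FullEmbedding C e f → FullEmbedding (restrictAlong C e f) e′ f′ → FullEmbedding C (e ∘ e′) (f ∘ f′)
∘-full {C} {e = e} {f} {e′} {f′} g g′ = record
  { points-inj  = G′.points-inj ∘ G.points-inj
  ; members-inj = G′.members-inj ∘ G.members-inj
  ; members-inside   = inside
  ; members-complete = complete }
  where
  module G = FullEmbedding g
  module G′ = FullEmbedding g′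
  inside : ∀ j → SupportIn (A C (f (f′ j))) (Image (e ∘ e′))
  inside j k a≢0 with G.members-inside (f′ j) k a≢0
  ... | k₁ , refl with G′.members-inside j k₁ a≢0
  ... | k₂ , refl = k₂ , refl
  complete : ∀ i → SupportIn (A C i) (Image (e ∘ e′)) → Image (f ∘ f′) i
  complete i h with G.members-complete i (λ k a≢0 → let (j , eq) = h k a≢0 in e′ j , eq)
  ... | i₁ , refl with G′.members-complete i₁ (λ k₁ a≢0 → let (j , eq) = h (e k₁) a≢0 in j , G.points-inj eq)
  ... | i₂ , refl = i₂ , refl

sameImage⇒MCIso : ∀ {C m s m′ s′} {e : Fin m → Fin (n C)} {f : Fin s → Fin (r C)}
                  {e′ : Fin m′ → Fin (n C)} {f′ : Fin s′ → Fin (r C)} →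
                  FullEmbedding C e f → FullEmbedding C e′ f′ →
                  (∀ k → Image e k → Image e′ k) → (∀ k → Image e′ k → Image e k) →
                  MCIso (restrictAlong C e f) (restrictAlong C e′ f′)
sameImage⇒MCIso {C} {m} {s} {m′} {s′} {e} {f} {e′} {f′} g g′ ⊆ ⊇ = record
  { σ = proj₁ points ; τ = proj₁ members
  ; A-pres  = λ i k → cong₂ (A C) (proj₂ members i) (proj₂ points k)
  ; le-pres = λ i j → cong₂ (le C) (proj₂ members i) (proj₂ members j) }
  where
  module G = FullEmbedding g
  module G′ = FullEmbedding g′
  points : Σ (Fin m ↔ Fin m′) λ σ → ∀ j → e′ (to σ j) ≡ e j
  points = sameImage⇒↔ e e′ G.points-inj G′.points-inj (λ j → ⊆ (e j) (j , refl)) (λ j → ⊇ (e′ j) (j , refl))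
  members : Σ (Fin s ↔ Fin s′) λ τ → ∀ j → f′ (to τ j) ≡ f j
  members = sameImage⇒↔ f f′ G.members-inj G′.members-inj
              (λ j → G′.members-complete (f j) (λ k a≢0 → ⊆ k (G.members-inside j k a≢0)))
              (λ j → G.members-complete (f′ j) (λ k a≢0 → ⊇ k (G′.members-inside j k a≢0)))

MCIso-full : ∀ {C C′ m s} {e : Fin m → Fin (n C)} {f : Fin s → Fin (r C)} (φ : MCIso C C′) →
             let open MCIso φ in
             FullEmbedding C e f →
             FullEmbedding C′ (to σ ∘ e) (to τ ∘ f) × MCIso (restrictAlong C e f) (restrictAlong C′ (to σ ∘ e) (to τ ∘ f))
MCIso-full {C} {C′} {e = e} {f} φ g =
  record { points-inj  = G.points-inj ∘ to-injective σ
         ; members-inj = G.members-inj ∘ to-injective τ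
         ; members-inside = inside ; members-complete = complete } ,
  record { σ = ↔-refl ; τ = ↔-refl ; A-pres = λ i k → A-pres (f i) (e k) ; le-pres = λ i j → le-pres (f i) (f j) }
  where
  open MCIso φ
  module G = FullEmbedding g
  inside : ∀ j → SupportIn (A C′ (to τ (f j))) (Image (to σ ∘ e))
  inside j k a≢0 with G.members-inside j (from σ k)
                       (λ z → a≢0 (trans (cong (A C′ (to τ (f j))) (sym (to∘from σ k)))
                                         (trans (A-pres (f j) (from σ k)) z)))
  ... | k₁ , eq = k₁ , trans (cong (to σ) eq) (to∘from σ k)
  complete : ∀ i → SupportIn (A C′ i) (Image (to σ ∘ e)) → Image (to τ ∘ f) i
  complete i h with G.members-complete (from τ i) (λ k a≢0 →
                 let (j , eq) = h (to σ k) (λ z → a≢0 (trans (sym (A-pres (from τ i) k))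
                                  (trans (cong (λ u → A C′ u (to σ k)) (to∘from τ i)) z)))
                 in j , to-injective σ eq)
  ... | i₁ , eq = i₁ , trans (cong (to τ) eq) (to∘from τ i)

singleton-along⁻ : ∀ {C m s} {e : Fin m → Fin (n C)} {f : Fin s → Fin (r C)} → FullEmbedding C e f →
                   ∀ i k → IsSingleton (A (restrictAlong C e f) i) k → IsSingleton (A C (f i)) (e k)
singleton-along⁻ {C} {e = e} {f} g i k (one , zeros) = one , rest
  where
  rest : ∀ k′ → ¬ k′ ≡ e k → A C (f i) k′ ≡ 0
  rest k′ k′≢ek with A C (f i) k′ ≟ℕ 0
  ... | yes p   = p
  ... | no a≢0 with FullEmbedding.members-inside g i k′ a≢0
  ... | j , refl = zeros j (k′≢ek ∘ cong e)

singleton-along⁺ : ∀ {C m s} {e : Fin m → Fin (n C)} {f : Fin s → Fin (r C)} → FullEmbedding C e f →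
                   ∀ i k → IsSingleton (A C (f i)) (e k) → IsSingleton (A (restrictAlong C e f) i) k
singleton-along⁺ g i k (one , zeros) = one , λ k′ k′≢k → zeros _ (k′≢k ∘ FullEmbedding.points-inj g)

restrictAlong-valid : ∀ {C m s} {e : Fin m → Fin (n C)} {f : Fin s → Fin (r C)} →
                      IsMC C → FullEmbedding C e f → IsMC (restrictAlong C e f)
restrictAlong-valid {C} {e = e} {f} v g = record
  { nonempty     = nonempty
  ; le-refl      = λ i → V.le-refl (f i)
  ; le-antisym   = λ i j p q → G.members-inj (V.le-antisym (f i) (f j) p q)
  ; le-trans     = λ i j l → V.le-trans (f i) (f j) (f l)
  ; singleton    = singleton
  ; singleton-le = λ k i j s → V.singleton-le (e k) (f i) (f j) (singleton-along⁻ g i k s)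
  ; contained    = λ i j t k → V.contained (f i) (f j) t (e k) }
  where
  module V = IsMC v
  module G = FullEmbedding g
  C′ : MC
  C′ = restrictAlong C e f
  nonempty : ∀ i → ∃ λ k → ¬ (A C (f i) (e k) ≡ 0)
  nonempty i with V.nonempty (f i)
  ... | k , a≢0 with G.members-inside i k a≢0
  ... | j , refl = j , a≢0
  singleton : ∀ k → Σ _ λ i → IsSingleton (A C′ i) k × (∀ i′ → IsSingleton (A C′ i′) k → i′ ≡ i)
  singleton k with V.singleton (e k)
  ... | i₀ , s , unique with G.members-complete i₀ (λ k′ a≢0 → inside k′ a≢0)
    where
    inside : ∀ k′ → ¬ A C i₀ k′ ≡ 0 → Image e k′
    inside k′ a≢0 with k′ FinP.≟ e k
    ... | yes eq  = k , sym eq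
    ... | no k′≢ek = ⊥-elim (a≢0 (proj₂ s k′ k′≢ek))
  ... | i₁ , refl =
    i₁ , singleton-along⁺ g i₁ k s , λ i′ s′ → G.members-inj (unique (f i′) (singleton-along⁻ g i′ k s′))

restrict-isMC : ∀ C X → IsMC C → IsMC (restrict C X)
restrict-isMC C X v = restrictAlong-valid v (restrict-full C X)

data SplitView (m n : ℕ) : Fin (m + n) → Set where
  inl : (i : Fin m) → SplitView m n (i ↑ˡ n)
  inr : (j : Fin n) → SplitView m n (m ↑ʳ j)

splitView : ∀ m n (i : Fin (m + n)) → SplitView m n i
splitView zero n i = inr i
splitView (suc m) n zero = inl zero
splitView (suc m) n (suc i) with splitView m n i
... | inl i′ = inl (suc i′)
... | inr j = inr j

module _ (C D : MC) where
  A-ll : ∀ i k → A (C ⊔MC D) (i ↑ˡ r D) (k ↑ˡ n D) ≡ A C i k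
  A-ll i k rewrite FinP.splitAt-↑ˡ (r C) i (r D) | FinP.splitAt-↑ˡ (n C) k (n D) = refl
  A-lr : ∀ i k → A (C ⊔MC D) (i ↑ˡ r D) (n C ↑ʳ k) ≡ 0
  A-lr i k rewrite FinP.splitAt-↑ˡ (r C) i (r D) | FinP.splitAt-↑ʳ (n C) (n D) k = refl
  A-rl : ∀ i k → A (C ⊔MC D) (r C ↑ʳ i) (k ↑ˡ n D) ≡ 0
  A-rl i k rewrite FinP.splitAt-↑ʳ (r C) (r D) i | FinP.splitAt-↑ˡ (n C) k (n D) = refl
  A-rr : ∀ i k → A (C ⊔MC D) (r C ↑ʳ i) (n C ↑ʳ k) ≡ A D i k
  A-rr i k rewrite FinP.splitAt-↑ʳ (r C) (r D) i | FinP.splitAt-↑ʳ (n C) (n D) k = refl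
  le-ll : ∀ i j → le (C ⊔MC D) (i ↑ˡ r D) (j ↑ˡ r D) ≡ le C i j
  le-ll i j rewrite FinP.splitAt-↑ˡ (r C) i (r D) | FinP.splitAt-↑ˡ (r C) j (r D) = refl
  le-lr : ∀ i j → le (C ⊔MC D) (i ↑ˡ r D) (r C ↑ʳ j) ≡ false
  le-lr i j rewrite FinP.splitAt-↑ˡ (r C) i (r D) | FinP.splitAt-↑ʳ (r C) (r D) j = refl
  le-rl : ∀ i j → le (C ⊔MC D) (r C ↑ʳ i) (j ↑ˡ r D) ≡ false
  le-rl i j rewrite FinP.splitAt-↑ʳ (r C) (r D) i | FinP.splitAt-↑ˡ (r C) j (r D) = refl
  le-rr : ∀ i j → le (C ⊔MC D) (r C ↑ʳ i) (r C ↑ʳ j) ≡ le D i j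
  le-rr i j rewrite FinP.splitAt-↑ʳ (r C) (r D) i | FinP.splitAt-↑ʳ (r C) (r D) j = refl

  singleton-↑ˡ : ∀ i k → IsSingleton (A C i) k → IsSingleton (A (C ⊔MC D) (i ↑ˡ r D)) (k ↑ˡ n D)
  singleton-↑ˡ i k (o , z) = trans (A-ll i k) o , h
    where
    h : ∀ k′ → ¬ k′ ≡ k ↑ˡ n D → A (C ⊔MC D) (i ↑ˡ r D) k′ ≡ 0
    h k′ ne with splitView (n C) (n D) k′
    ... | inl k₁ = trans (A-ll i k₁) (z k₁ (λ eq → ne (cong (_↑ˡ n D) eq)))
    ... | inr k₂ = A-lr i k₂
  singleton-↑ˡ⁻ : ∀ i k → IsSingleton (A (C ⊔MC D) (i ↑ˡ r D)) (k ↑ˡ n D) → IsSingleton (A C i) k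
  singleton-↑ˡ⁻ i k (o , z) = trans (sym (A-ll i k)) o ,
    λ k′ ne → trans (sym (A-ll i k′)) (z (k′ ↑ˡ n D) (λ eq → ne (FinP.↑ˡ-injective (n D) k′ k eq)))
  singleton-↑ʳ : ∀ i k → IsSingleton (A D i) k → IsSingleton (A (C ⊔MC D) (r C ↑ʳ i)) (n C ↑ʳ k)
  singleton-↑ʳ i k (o , z) = trans (A-rr i k) o , h
    where
    h : ∀ k′ → ¬ k′ ≡ n C ↑ʳ k → A (C ⊔MC D) (r C ↑ʳ i) k′ ≡ 0
    h k′ ne with splitView (n C) (n D) k′
    ... | inl k₁ = A-rl i k₁
    ... | inr k₂ = trans (A-rr i k₂) (z k₂ (λ eq → ne (cong (n C ↑ʳ_) eq)))
  singleton-↑ʳ⁻ : ∀ i k → IsSingleton (A (C ⊔MC D) (r C ↑ʳ i)) (n C ↑ʳ k) → IsSingleton (A D i) k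
  singleton-↑ʳ⁻ i k (o , z) = trans (sym (A-rr i k)) o ,
    λ k′ ne → trans (sym (A-rr i k′)) (z (n C ↑ʳ k′) (λ eq → ne (FinP.↑ʳ-injective (n C) k′ k eq)))
  ¬singleton-↑ˡ↑ʳ : ∀ i k → ¬ IsSingleton (A (C ⊔MC D) (i ↑ˡ r D)) (n C ↑ʳ k)
  ¬singleton-↑ˡ↑ʳ i k (o , _) with trans (sym (A-lr i k)) o
  ... | ()
  ¬singleton-↑ʳ↑ˡ : ∀ i k → ¬ IsSingleton (A (C ⊔MC D) (r C ↑ʳ i)) (k ↑ˡ n D)
  ¬singleton-↑ʳ↑ˡ i k (o , _) with trans (sym (A-rl i k)) o
  ... | ()

↑ˡ≢↑ʳ : ∀ {m n} (i : Fin m) (j : Fin n) → ¬ (i ↑ˡ n) ≡ (m ↑ʳ j)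
↑ˡ≢↑ʳ {m} {n} i j eq with trans (sym (FinP.splitAt-↑ˡ m i n)) (trans (cong (splitAt m) eq) (FinP.splitAt-↑ʳ m n j))
... | ()

T-false : ∀ {b} → b ≡ false → ¬ T b
T-false refl ()

module _ {C D : MC} (vC : IsMC C) (vD : IsMC D) where
  private
    module VC = IsMC vC
    module VD = IsMC vD
    E : MC
    E = C ⊔MC D


  ⊔-nonempty : ∀ i → ∃ λ k → ¬ (A E i k ≡ 0)
  ⊔-nonempty i with splitView (r C) (r D) i
  ... | inl i₁ = let (k , a≢0) = VC.nonempty i₁ in k ↑ˡ n D , λ z → a≢0 (trans (sym (A-ll C D i₁ k)) z)
  ... | inr i₂ = let (k , a≢0) = VD.nonempty i₂ in n C ↑ʳ k , λ z → a≢0 (trans (sym (A-rr C D i₂ k)) z)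

  ⊔-le-refl : ∀ i → T (le E i i)
  ⊔-le-refl i with splitView (r C) (r D) i
  ... | inl i₁ = subst T (sym (le-ll C D i₁ i₁)) (VC.le-refl i₁)
  ... | inr i₂ = subst T (sym (le-rr C D i₂ i₂)) (VD.le-refl i₂)

  ⊔-le-antisym : ∀ i j → T (le E i j) → T (le E j i) → i ≡ j
  ⊔-le-antisym i j p q with splitView (r C) (r D) i | splitView (r C) (r D) j
  ... | inl i₁ | inl j₁ = cong (_↑ˡ r D) (VC.le-antisym i₁ j₁ (subst T (le-ll C D i₁ j₁) p) (subst T (le-ll C D j₁ i₁) q))
  ... | inl i₁ | inr j₂ = ⊥-elim (T-false (le-lr C D i₁ j₂) p)
  ... | inr i₂ | inl j₁ = ⊥-elim (T-false (le-rl C D i₂ j₁) p)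
  ... | inr i₂ | inr j₂ = cong (r C ↑ʳ_) (VD.le-antisym i₂ j₂ (subst T (le-rr C D i₂ j₂) p) (subst T (le-rr C D j₂ i₂) q))

  ⊔-le-trans : ∀ i j l → T (le E i j) → T (le E j l) → T (le E i l)
  ⊔-le-trans i j l p q with splitView (r C) (r D) i | splitView (r C) (r D) j | splitView (r C) (r D) l
  ... | inl i₁ | inl j₁ | inl l₁ = subst T (sym (le-ll C D i₁ l₁)) (VC.le-trans i₁ j₁ l₁ (subst T (le-ll C D i₁ j₁) p) (subst T (le-ll C D j₁ l₁) q))
  ... | inl i₁ | inl j₁ | inr l₂ = ⊥-elim (T-false (le-lr C D j₁ l₂) q)
  ... | inl i₁ | inr j₂ | _ = ⊥-elim (T-false (le-lr C D i₁ j₂) p)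
  ... | inr i₂ | inl j₁ | _ = ⊥-elim (T-false (le-rl C D i₂ j₁) p)
  ... | inr i₂ | inr j₂ | inl l₁ = ⊥-elim (T-false (le-rl C D j₂ l₁) q)
  ... | inr i₂ | inr j₂ | inr l₂ = subst T (sym (le-rr C D i₂ l₂)) (VD.le-trans i₂ j₂ l₂ (subst T (le-rr C D i₂ j₂) p) (subst T (le-rr C D j₂ l₂) q))

  ⊔-singleton : ∀ k → Σ _ λ i → IsSingleton (A E i) k × (∀ i′ → IsSingleton (A E i′) k → i′ ≡ i)
  ⊔-singleton k with splitView (n C) (n D) k
  ... | inl k₁ = let (i₀ , s , u) = VC.singleton k₁ in
    i₀ ↑ˡ r D , singleton-↑ˡ C D i₀ k₁ s , λ i′ s′ → h i′ s′ (splitView (r C) (r D) i′)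
    where
    h : ∀ i′ → IsSingleton (A E i′) (k₁ ↑ˡ n D) → SplitView (r C) (r D) i′ → i′ ≡ proj₁ (VC.singleton k₁) ↑ˡ r D
    h .(i₁ ↑ˡ r D) s′ (inl i₁) = cong (_↑ˡ r D) (proj₂ (proj₂ (VC.singleton k₁)) i₁ (singleton-↑ˡ⁻ C D i₁ k₁ s′))
    h .(r C ↑ʳ i₂) s′ (inr i₂) = ⊥-elim (¬singleton-↑ʳ↑ˡ C D i₂ k₁ s′)
  ... | inr k₂ = let (i₀ , s , u) = VD.singleton k₂ in
    r C ↑ʳ i₀ , singleton-↑ʳ C D i₀ k₂ s , λ i′ s′ → h i′ s′ (splitView (r C) (r D) i′)
    where
    h : ∀ i′ → IsSingleton (A E i′) (n C ↑ʳ k₂) → SplitView (r C) (r D) i′ → i′ ≡ r C ↑ʳ proj₁ (VD.singleton k₂)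
    h .(i₁ ↑ˡ r D) s′ (inl i₁) = ⊥-elim (¬singleton-↑ˡ↑ʳ C D i₁ k₂ s′)
    h .(r C ↑ʳ i₂) s′ (inr i₂) = cong (r C ↑ʳ_) (proj₂ (proj₂ (VD.singleton k₂)) i₂ (singleton-↑ʳ⁻ C D i₂ k₂ s′))

  ⊔-singleton-le : ∀ k i j → IsSingleton (A E i) k → T (le E i j) ⇔ (¬ A E j k ≡ 0)
  ⊔-singleton-le k i j s with splitView (n C) (n D) k | splitView (r C) (r D) i | splitView (r C) (r D) j
  ... | inl k₁ | inl i₁ | inl j₁ =
    let eqv = VC.singleton-le k₁ i₁ j₁ (singleton-↑ˡ⁻ C D i₁ k₁ s) in
    mk⇔ (λ t z → Equivalence.to eqv (subst T (le-ll C D i₁ j₁) t) (trans (sym (A-ll C D j₁ k₁)) z))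
        (λ a≢0 → subst T (sym (le-ll C D i₁ j₁)) (Equivalence.from eqv (λ z → a≢0 (trans (A-ll C D j₁ k₁) z))))
  ... | inl k₁ | inl i₁ | inr j₂ =
    mk⇔ (λ t → ⊥-elim (T-false (le-lr C D i₁ j₂) t)) (λ a≢0 → ⊥-elim (a≢0 (A-rl C D j₂ k₁)))
  ... | inl k₁ | inr i₂ | _ = ⊥-elim (¬singleton-↑ʳ↑ˡ C D i₂ k₁ s)
  ... | inr k₂ | inl i₁ | _ = ⊥-elim (¬singleton-↑ˡ↑ʳ C D i₁ k₂ s)
  ... | inr k₂ | inr i₂ | inl j₁ =
    mk⇔ (λ t → ⊥-elim (T-false (le-rl C D i₂ j₁) t)) (λ a≢0 → ⊥-elim (a≢0 (A-lr C D j₁ k₂)))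
  ... | inr k₂ | inr i₂ | inr j₂ =
    let eqv = VD.singleton-le k₂ i₂ j₂ (singleton-↑ʳ⁻ C D i₂ k₂ s) in
    mk⇔ (λ t z → Equivalence.to eqv (subst T (le-rr C D i₂ j₂) t) (trans (sym (A-rr C D j₂ k₂)) z))
        (λ a≢0 → subst T (sym (le-rr C D i₂ j₂)) (Equivalence.from eqv (λ z → a≢0 (trans (A-rr C D j₂ k₂) z))))

  ⊔-contained : ∀ i j → T (le E i j) → ∀ k → A E i k ≤ A E j k
  ⊔-contained i j t k with splitView (r C) (r D) i | splitView (r C) (r D) j | splitView (n C) (n D) k
  ... | inl i₁ | inl j₁ | inl k₁ rewrite A-ll C D i₁ k₁ | A-ll C D j₁ k₁ = VC.contained i₁ j₁ (subst T (le-ll C D i₁ j₁) t) k₁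
  ... | inl i₁ | inl j₁ | inr k₂ rewrite A-lr C D i₁ k₂ = z≤n
  ... | inl i₁ | inr j₂ | _ = ⊥-elim (T-false (le-lr C D i₁ j₂) t)
  ... | inr i₂ | inl j₁ | _ = ⊥-elim (T-false (le-rl C D i₂ j₁) t)
  ... | inr i₂ | inr j₂ | inl k₁ rewrite A-rl C D i₂ k₁ = z≤n
  ... | inr i₂ | inr j₂ | inr k₂ rewrite A-rr C D i₂ k₂ | A-rr C D j₂ k₂ = VD.contained i₂ j₂ (subst T (le-rr C D i₂ j₂) t) k₂

⊔-isMC : ∀ C D → IsMC C → IsMC D → IsMC (C ⊔MC D)
⊔-isMC C D vC vD = record
  { nonempty     = ⊔-nonempty vC vD
  ; le-refl      = ⊔-le-refl vC vD
  ; le-antisym   = ⊔-le-antisym vC vD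
  ; le-trans     = ⊔-le-trans vC vD
  ; singleton    = ⊔-singleton vC vD
  ; singleton-le = ⊔-singleton-le vC vD
  ; contained    = ⊔-contained vC vD }

⊕-map : ∀ {m m′ n n′} → (Fin m → Fin m′) → (Fin n → Fin n′) → Fin (m + n) → Fin (m′ + n′)
⊕-map {m} {m′} {n} {n′} f g x with splitAt m x
... | inj₁ a = f a ↑ˡ n′
... | inj₂ b = m′ ↑ʳ g b

⊕-map-↑ˡ : ∀ {m m′ n n′} (f : Fin m → Fin m′) (g : Fin n → Fin n′) i → ⊕-map f g (i ↑ˡ n) ≡ f i ↑ˡ n′
⊕-map-↑ˡ {m} {n = n} f g i rewrite FinP.splitAt-↑ˡ m i n = refl

⊕-map-↑ʳ : ∀ {m m′ n n′} (f : Fin m → Fin m′) (g : Fin n → Fin n′) j → ⊕-map f g (m ↑ʳ j) ≡ m′ ↑ʳ g j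
⊕-map-↑ʳ {m} {n = n} f g j rewrite FinP.splitAt-↑ʳ m n j = refl

⊕-↔ : ∀ {m m′ n n′} → Fin m ↔ Fin m′ → Fin n ↔ Fin n′ → Fin (m + n) ↔ Fin (m′ + n′)
⊕-↔ {m} {m′} {n} {n′} σ ρ = mk↔ₛ′ (⊕-map (to σ) (to ρ)) (⊕-map (from σ) (from ρ)) inverseˡ inverseʳ
  where
  inverseˡ : ∀ y → ⊕-map (to σ) (to ρ) (⊕-map (from σ) (from ρ) y) ≡ y
  inverseˡ y with splitView m′ n′ y
  ... | inl a rewrite ⊕-map-↑ˡ (from σ) (from ρ) a | ⊕-map-↑ˡ (to σ) (to ρ) (from σ a) = cong (_↑ˡ n′) (to∘from σ a)
  ... | inr b rewrite ⊕-map-↑ʳ (from σ) (from ρ) b | ⊕-map-↑ʳ (to σ) (to ρ) (from ρ b) = cong (m′ ↑ʳ_) (to∘from ρ b)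
  inverseʳ : ∀ x → ⊕-map (from σ) (from ρ) (⊕-map (to σ) (to ρ) x) ≡ x
  inverseʳ x with splitView m n x
  ... | inl a rewrite ⊕-map-↑ˡ (to σ) (to ρ) a | ⊕-map-↑ˡ (from σ) (from ρ) (to σ a) = cong (_↑ˡ n) (from∘to σ a)
  ... | inr b rewrite ⊕-map-↑ʳ (to σ) (to ρ) b | ⊕-map-↑ʳ (from σ) (from ρ) (to ρ b) = cong (m ↑ʳ_) (from∘to ρ b)

⊔-MCIso : ∀ {C C′ D D′} → MCIso C C′ → MCIso D D′ → MCIso (C ⊔MC D) (C′ ⊔MC D′)
⊔-MCIso {C} {C′} {D} {D′} φ ψ = record
  { σ = ⊕-↔ (MCIso.σ φ) (MCIso.σ ψ) ; τ = ⊕-↔ (MCIso.τ φ) (MCIso.τ ψ) ; A-pres = A-eq ; le-pres = le-eq }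
  where
  tσ : Fin (n C) → Fin (n C′)
  tσ = to (MCIso.σ φ)
  tσ′ : Fin (n D) → Fin (n D′)
  tσ′ = to (MCIso.σ ψ)
  tτ : Fin (r C) → Fin (r C′)
  tτ = to (MCIso.τ φ)
  tτ′ : Fin (r D) → Fin (r D′)
  tτ′ = to (MCIso.τ ψ)
  A-eq : ∀ i k → A (C′ ⊔MC D′) (⊕-map tτ tτ′ i) (⊕-map tσ tσ′ k) ≡ A (C ⊔MC D) i k
  A-eq i k with splitView (r C) (r D) i | splitView (n C) (n D) k
  ... | inl i₁ | inl k₁ rewrite ⊕-map-↑ˡ tτ tτ′ i₁ | ⊕-map-↑ˡ tσ tσ′ k₁ | A-ll C′ D′ (tτ i₁) (tσ k₁) | A-ll C D i₁ k₁ = MCIso.A-pres φ i₁ k₁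
  ... | inl i₁ | inr k₂ rewrite ⊕-map-↑ˡ tτ tτ′ i₁ | ⊕-map-↑ʳ tσ tσ′ k₂ | A-lr C′ D′ (tτ i₁) (tσ′ k₂) | A-lr C D i₁ k₂ = refl
  ... | inr i₂ | inl k₁ rewrite ⊕-map-↑ʳ tτ tτ′ i₂ | ⊕-map-↑ˡ tσ tσ′ k₁ | A-rl C′ D′ (tτ′ i₂) (tσ k₁) | A-rl C D i₂ k₁ = refl
  ... | inr i₂ | inr k₂ rewrite ⊕-map-↑ʳ tτ tτ′ i₂ | ⊕-map-↑ʳ tσ tσ′ k₂ | A-rr C′ D′ (tτ′ i₂) (tσ′ k₂) | A-rr C D i₂ k₂ = MCIso.A-pres ψ i₂ k₂
  le-eq : ∀ i j → le (C′ ⊔MC D′) (⊕-map tτ tτ′ i) (⊕-map tτ tτ′ j) ≡ le (C ⊔MC D) i j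
  le-eq i j with splitView (r C) (r D) i | splitView (r C) (r D) j
  ... | inl i₁ | inl j₁ rewrite ⊕-map-↑ˡ tτ tτ′ i₁ | ⊕-map-↑ˡ tτ tτ′ j₁ | le-ll C′ D′ (tτ i₁) (tτ j₁) | le-ll C D i₁ j₁ = MCIso.le-pres φ i₁ j₁
  ... | inl i₁ | inr j₂ rewrite ⊕-map-↑ˡ tτ tτ′ i₁ | ⊕-map-↑ʳ tτ tτ′ j₂ | le-lr C′ D′ (tτ i₁) (tτ′ j₂) | le-lr C D i₁ j₂ = refl
  ... | inr i₂ | inl j₁ rewrite ⊕-map-↑ʳ tτ tτ′ i₂ | ⊕-map-↑ˡ tτ tτ′ j₁ | le-rl C′ D′ (tτ′ i₂) (tτ j₁) | le-rl C D i₂ j₁ = refl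
  ... | inr i₂ | inr j₂ rewrite ⊕-map-↑ʳ tτ tτ′ i₂ | ⊕-map-↑ʳ tτ tτ′ j₂ | le-rr C′ D′ (tτ′ i₂) (tτ′ j₂) | le-rr C D i₂ j₂ = MCIso.le-pres ψ i₂ j₂

⊕-injective : ∀ {a a′ b b′} {g : Fin a → Fin a′} {h : Fin b → Fin b′} →
              Injective _≡_ _≡_ g → Injective _≡_ _≡_ h → Injective _≡_ _≡_ (⊕-map g h)
⊕-injective {a} {a′} {b} {b′} {g} {h} gi hi {x} {y} eq with splitView a b x | splitView a b y
... | inl x₁ | inl y₁ = cong (_↑ˡ b) (gi (FinP.↑ˡ-injective b′ _ _ (trans (sym (⊕-map-↑ˡ g h x₁)) (trans eq (⊕-map-↑ˡ g h y₁)))))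
... | inl x₁ | inr y₂ = ⊥-elim (↑ˡ≢↑ʳ _ _ (trans (sym (⊕-map-↑ˡ g h x₁)) (trans eq (⊕-map-↑ʳ g h y₂))))
... | inr x₂ | inl y₁ = ⊥-elim (↑ˡ≢↑ʳ _ _ (sym (trans (sym (⊕-map-↑ʳ g h x₂)) (trans eq (⊕-map-↑ˡ g h y₁)))))
... | inr x₂ | inr y₂ = cong (a ↑ʳ_) (hi (FinP.↑ʳ-injective a′ _ _ (trans (sym (⊕-map-↑ʳ g h x₂)) (trans eq (⊕-map-↑ʳ g h y₂)))))

module _ {C D : MC} {m s m′ s′} {e : Fin m → Fin (n C)} {f : Fin s → Fin (r C)}
         {e′ : Fin m′ → Fin (n D)} {f′ : Fin s′ → Fin (r D)} where
  private
    E = C ⊔MC D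
    e⊕ : Fin (m + m′) → Fin (n C + n D)
    e⊕ = ⊕-map e e′
    f⊕ : Fin (s + s′) → Fin (r C + r D)
    f⊕ = ⊕-map f f′

  ⊕-full : FullEmbedding C e f → FullEmbedding D e′ f′ → FullEmbedding E e⊕ f⊕
  ⊕-full g g′ = record
    { points-inj       = ⊕-injective G.points-inj G′.points-inj
    ; members-inj      = ⊕-injective G.members-inj G′.members-inj
    ; members-inside   = img
    ; members-complete = sur }
    where
    module G = FullEmbedding g
    module G′ = FullEmbedding g′
    img : ∀ j → SupportIn (A E (f⊕ j)) (Image e⊕)
    img j k a≢0 with splitView s s′ j | splitView (n C) (n D) k
    ... | inl j₁ | inl k₁ rewrite ⊕-map-↑ˡ f f′ j₁ | A-ll C D (f j₁) k₁ with G.members-inside j₁ k₁ a≢0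
    ... | x , refl = x ↑ˡ m′ , ⊕-map-↑ˡ e e′ x
    img j k a≢0 | inl j₁ | inr k₂ rewrite ⊕-map-↑ˡ f f′ j₁ | A-lr C D (f j₁) k₂ = ⊥-elim (a≢0 refl)
    img j k a≢0 | inr j₂ | inl k₁ rewrite ⊕-map-↑ʳ f f′ j₂ | A-rl C D (f′ j₂) k₁ = ⊥-elim (a≢0 refl)
    img j k a≢0 | inr j₂ | inr k₂ rewrite ⊕-map-↑ʳ f f′ j₂ | A-rr C D (f′ j₂) k₂ with G′.members-inside j₂ k₂ a≢0
    ... | x , refl = m ↑ʳ x , ⊕-map-↑ʳ e e′ x
    sur : ∀ i → SupportIn (A E i) (Image e⊕) → Image f⊕ i
    sur i h with splitView (r C) (r D) i
    ... | inl i₁ with G.members-complete i₁ (λ k a≢0 → back k (h (k ↑ˡ n D) (λ z → a≢0 (trans (sym (A-ll C D i₁ k)) z))))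
      where
      back : ∀ k → Image e⊕ (k ↑ˡ n D) → Image e k
      back k (x , eq) with splitView m m′ x
      ... | inl x₁ = x₁ , FinP.↑ˡ-injective (n D) _ _ (trans (sym (⊕-map-↑ˡ e e′ x₁)) eq)
      ... | inr x₂ = ⊥-elim (↑ˡ≢↑ʳ _ _ (sym (trans (sym (⊕-map-↑ʳ e e′ x₂)) eq)))
    ... | y , refl = y ↑ˡ s′ , ⊕-map-↑ˡ f f′ y
    sur i h | inr i₂ with G′.members-complete i₂ (λ k a≢0 → back k (h (n C ↑ʳ k) (λ z → a≢0 (trans (sym (A-rr C D i₂ k)) z))))
      where
      back : ∀ k → Image e⊕ (n C ↑ʳ k) → Image e′ k
      back k (x , eq) with splitView m m′ x
      ... | inl x₁ = ⊥-elim (↑ˡ≢↑ʳ _ _ (trans (sym (⊕-map-↑ˡ e e′ x₁)) eq))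
      ... | inr x₂ = x₂ , FinP.↑ʳ-injective (n C) _ _ (trans (sym (⊕-map-↑ʳ e e′ x₂)) eq)
    ... | y , refl = s ↑ʳ y , ⊕-map-↑ʳ f f′ y

  restrictAlong-⊔ : MCIso (restrictAlong C e f ⊔MC restrictAlong D e′ f′) (restrictAlong E e⊕ f⊕)
  restrictAlong-⊔ = record { σ = ↔-refl ; τ = ↔-refl ; A-pres = A-eq ; le-pres = le-eq }
    where
    A-eq : ∀ i k → A E (f⊕ i) (e⊕ k) ≡ A (restrictAlong C e f ⊔MC restrictAlong D e′ f′) i k
    A-eq i k with splitView s s′ i | splitView m m′ k
    ... | inl i₁ | inl k₁ rewrite ⊕-map-↑ˡ f f′ i₁ | ⊕-map-↑ˡ e e′ k₁ | A-ll C D (f i₁) (e k₁) | A-ll (restrictAlong C e f) (restrictAlong D e′ f′) i₁ k₁ = refl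
    ... | inl i₁ | inr k₂ rewrite ⊕-map-↑ˡ f f′ i₁ | ⊕-map-↑ʳ e e′ k₂ | A-lr C D (f i₁) (e′ k₂) | A-lr (restrictAlong C e f) (restrictAlong D e′ f′) i₁ k₂ = refl
    ... | inr i₂ | inl k₁ rewrite ⊕-map-↑ʳ f f′ i₂ | ⊕-map-↑ˡ e e′ k₁ | A-rl C D (f′ i₂) (e k₁) | A-rl (restrictAlong C e f) (restrictAlong D e′ f′) i₂ k₁ = refl
    ... | inr i₂ | inr k₂ rewrite ⊕-map-↑ʳ f f′ i₂ | ⊕-map-↑ʳ e e′ k₂ | A-rr C D (f′ i₂) (e′ k₂) | A-rr (restrictAlong C e f) (restrictAlong D e′ f′) i₂ k₂ = refl
    le-eq : ∀ i j → le E (f⊕ i) (f⊕ j) ≡ le (restrictAlong C e f ⊔MC restrictAlong D e′ f′) i j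
    le-eq i j with splitView s s′ i | splitView s s′ j
    ... | inl i₁ | inl j₁ rewrite ⊕-map-↑ˡ f f′ i₁ | ⊕-map-↑ˡ f f′ j₁ | le-ll C D (f i₁) (f j₁) | le-ll (restrictAlong C e f) (restrictAlong D e′ f′) i₁ j₁ = refl
    ... | inl i₁ | inr j₂ rewrite ⊕-map-↑ˡ f f′ i₁ | ⊕-map-↑ʳ f f′ j₂ | le-lr C D (f i₁) (f′ j₂) | le-lr (restrictAlong C e f) (restrictAlong D e′ f′) i₁ j₂ = refl
    ... | inr i₂ | inl j₁ rewrite ⊕-map-↑ʳ f f′ i₂ | ⊕-map-↑ˡ f f′ j₁ | le-rl C D (f′ i₂) (f j₁) | le-rl (restrictAlong C e f) (restrictAlong D e′ f′) i₂ j₁ = refl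
    ... | inr i₂ | inr j₂ rewrite ⊕-map-↑ʳ f f′ i₂ | ⊕-map-↑ʳ f f′ j₂ | le-rr C D (f′ i₂) (f′ j₂) | le-rr (restrictAlong C e f) (restrictAlong D e′ f′) i₂ j₂ = refl

swap : ∀ {m n} → Fin (m + n) → Fin (n + m)
swap {m} {n} x with splitAt m x
... | inj₁ a = n ↑ʳ a
... | inj₂ b = b ↑ˡ m

swap-l : ∀ {m n} (i : Fin m) → swap {m} {n} (i ↑ˡ n) ≡ n ↑ʳ i
swap-l {m} {n} i rewrite FinP.splitAt-↑ˡ m i n = refl

swap-r : ∀ {m n} (j : Fin n) → swap {m} {n} (m ↑ʳ j) ≡ j ↑ˡ m
swap-r {m} {n} j rewrite FinP.splitAt-↑ʳ m n j = refl

swap-↔ : ∀ {m n} → Fin (m + n) ↔ Fin (n + m)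
swap-↔ {m} {n} = mk↔ₛ′ (swap {m} {n}) (swap {n} {m}) (involutive {n} {m}) (involutive {m} {n})
  where
  involutive : ∀ {a b} (x : Fin (a + b)) → swap {b} {a} (swap {a} {b} x) ≡ x
  involutive {a} {b} x with splitView a b x
  ... | inl i rewrite swap-l {a} {b} i | swap-r {b} {a} i = refl
  ... | inr j rewrite swap-r {a} {b} j | swap-l {b} {a} j = refl

⊔-comm : ∀ C D → MCIso (C ⊔MC D) (D ⊔MC C)
⊔-comm C D = record { σ = swap-↔ {n C} {n D} ; τ = swap-↔ {r C} {r D} ; A-pres = A-eq ; le-pres = le-eq }
  where
  A-eq : ∀ i k → A (D ⊔MC C) (swap {r C} {r D} i) (swap {n C} {n D} k) ≡ A (C ⊔MC D) i k
  A-eq i k with splitView (r C) (r D) i | splitView (n C) (n D) k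
  ... | inl i₁ | inl k₁ rewrite swap-l {r C} {r D} i₁ | swap-l {n C} {n D} k₁ | A-rr D C i₁ k₁ | A-ll C D i₁ k₁ = refl
  ... | inl i₁ | inr k₂ rewrite swap-l {r C} {r D} i₁ | swap-r {n C} {n D} k₂ | A-rl D C i₁ k₂ | A-lr C D i₁ k₂ = refl
  ... | inr i₂ | inl k₁ rewrite swap-r {r C} {r D} i₂ | swap-l {n C} {n D} k₁ | A-lr D C i₂ k₁ | A-rl C D i₂ k₁ = refl
  ... | inr i₂ | inr k₂ rewrite swap-r {r C} {r D} i₂ | swap-r {n C} {n D} k₂ | A-ll D C i₂ k₂ | A-rr C D i₂ k₂ = refl
  le-eq : ∀ i j → le (D ⊔MC C) (swap {r C} {r D} i) (swap {r C} {r D} j) ≡ le (C ⊔MC D) i j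
  le-eq i j with splitView (r C) (r D) i | splitView (r C) (r D) j
  ... | inl i₁ | inl j₁ rewrite swap-l {r C} {r D} i₁ | swap-l {r C} {r D} j₁ | le-rr D C i₁ j₁ | le-ll C D i₁ j₁ = refl
  ... | inl i₁ | inr j₂ rewrite swap-l {r C} {r D} i₁ | swap-r {r C} {r D} j₂ | le-rl D C i₁ j₂ | le-lr C D i₁ j₂ = refl
  ... | inr i₂ | inl j₁ rewrite swap-r {r C} {r D} i₂ | swap-l {r C} {r D} j₁ | le-lr D C i₂ j₁ | le-rl C D i₂ j₁ = refl
  ... | inr i₂ | inr j₂ rewrite swap-r {r C} {r D} i₂ | swap-r {r C} {r D} j₂ | le-ll D C i₂ j₂ | le-rr C D i₂ j₂ = refl

⊔-identityˡ : ∀ C → MCIso (∅MC ⊔MC C) C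
⊔-identityˡ C = record { σ = ↔-refl ; τ = ↔-refl ; A-pres = λ i k → refl ; le-pres = λ i j → refl }

drop+0 : ∀ {m} → Fin (m + 0) → Fin m
drop+0 {m} x with splitAt m x
... | inj₁ a = a
... | inj₂ ()

drop+0-↑ˡ : ∀ {m} (i : Fin m) → drop+0 (i ↑ˡ 0) ≡ i
drop+0-↑ˡ {m} i rewrite FinP.splitAt-↑ˡ m i 0 = refl

+0-↔ : ∀ {m} → Fin (m + 0) ↔ Fin m
+0-↔ {m} = mk↔ₛ′ drop+0 (_↑ˡ 0) drop+0-↑ˡ ↑ˡ0∘drop+0
  where
  ↑ˡ0∘drop+0 : ∀ x → drop+0 x ↑ˡ 0 ≡ x
  ↑ˡ0∘drop+0 x with splitView m 0 x
  ... | inl i rewrite drop+0-↑ˡ i = refl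
  ... | inr ()

⊔-identityʳ : ∀ C → MCIso (C ⊔MC ∅MC) C
⊔-identityʳ C = record { σ = +0-↔ ; τ = +0-↔ ; A-pres = A-eq ; le-pres = le-eq }
  where
  A-eq : ∀ i k → A C (drop+0 i) (drop+0 k) ≡ A (C ⊔MC ∅MC) i k
  A-eq i k with splitView (r C) 0 i | splitView (n C) 0 k
  ... | inl i₁ | inl k₁ rewrite drop+0-↑ˡ i₁ | drop+0-↑ˡ k₁ | A-ll C ∅MC i₁ k₁ = refl
  ... | inr () | _
  ... | _ | inr ()
  le-eq : ∀ i j → le C (drop+0 i) (drop+0 j) ≡ le (C ⊔MC ∅MC) i j
  le-eq i j with splitView (r C) 0 i | splitView (r C) 0 j
  ... | inl i₁ | inl j₁ rewrite drop+0-↑ˡ i₁ | drop+0-↑ˡ j₁ | le-ll C ∅MC i₁ j₁ = refl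
  ... | inr () | _
  ... | _ | inr ()

data View₃ˡ (a b c : ℕ) : Fin ((a + b) + c) → Set where
  l₁ : (p : Fin a) → View₃ˡ a b c ((p ↑ˡ b) ↑ˡ c)
  l₂ : (q : Fin b) → View₃ˡ a b c ((a ↑ʳ q) ↑ˡ c)
  l₃ : (z : Fin c) → View₃ˡ a b c ((a + b) ↑ʳ z)

view₃ˡ : ∀ a b c x → View₃ˡ a b c x
view₃ˡ a b c x with splitView (a + b) c x
... | inr z = l₃ z
... | inl y with splitView a b y
... | inl p = l₁ p
... | inr q = l₂ q

data View₃ʳ (a b c : ℕ) : Fin (a + (b + c)) → Set where
  r₁ : (p : Fin a) → View₃ʳ a b c (p ↑ˡ (b + c))
  r₂ : (q : Fin b) → View₃ʳ a b c (a ↑ʳ (q ↑ˡ c))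
  r₃ : (z : Fin c) → View₃ʳ a b c (a ↑ʳ (b ↑ʳ z))

view₃ʳ : ∀ a b c x → View₃ʳ a b c x
view₃ʳ a b c x with splitView a (b + c) x
... | inl p = r₁ p
... | inr y with splitView b c y
... | inl q = r₂ q
... | inr z = r₃ z

reassoc : ∀ {a b c} → Fin ((a + b) + c) → Fin (a + (b + c))
reassoc {a} {b} {c} x with splitAt (a + b) x
... | inj₂ z = a ↑ʳ (b ↑ʳ z)
... | inj₁ y with splitAt a y
... | inj₁ p = p ↑ˡ (b + c)
... | inj₂ q = a ↑ʳ (q ↑ˡ c)

unreassoc : ∀ {a b c} → Fin (a + (b + c)) → Fin ((a + b) + c)
unreassoc {a} {b} {c} x with splitAt a x
... | inj₁ p = (p ↑ˡ b) ↑ˡ c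
... | inj₂ y with splitAt b y
... | inj₁ q = (a ↑ʳ q) ↑ˡ c
... | inj₂ z = (a + b) ↑ʳ z

reassoc-₁ : ∀ {a b c} p → reassoc {a} {b} {c} ((p ↑ˡ b) ↑ˡ c) ≡ p ↑ˡ (b + c)
reassoc-₁ {a} {b} {c} p rewrite FinP.splitAt-↑ˡ (a + b) (p ↑ˡ b) c | FinP.splitAt-↑ˡ a p b = refl
reassoc-₂ : ∀ {a b c} q → reassoc {a} {b} {c} ((a ↑ʳ q) ↑ˡ c) ≡ a ↑ʳ (q ↑ˡ c)
reassoc-₂ {a} {b} {c} q rewrite FinP.splitAt-↑ˡ (a + b) (a ↑ʳ q) c | FinP.splitAt-↑ʳ a b q = refl
reassoc-₃ : ∀ {a b c} z → reassoc {a} {b} {c} ((a + b) ↑ʳ z) ≡ a ↑ʳ (b ↑ʳ z)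
reassoc-₃ {a} {b} {c} z rewrite FinP.splitAt-↑ʳ (a + b) c z = refl
unreassoc-₁ : ∀ {a b c} p → unreassoc {a} {b} {c} (p ↑ˡ (b + c)) ≡ (p ↑ˡ b) ↑ˡ c
unreassoc-₁ {a} {b} {c} p rewrite FinP.splitAt-↑ˡ a p (b + c) = refl
unreassoc-₂ : ∀ {a b c} q → unreassoc {a} {b} {c} (a ↑ʳ (q ↑ˡ c)) ≡ (a ↑ʳ q) ↑ˡ c
unreassoc-₂ {a} {b} {c} q rewrite FinP.splitAt-↑ʳ a (b + c) (q ↑ˡ c) | FinP.splitAt-↑ˡ b q c = refl
unreassoc-₃ : ∀ {a b c} z → unreassoc {a} {b} {c} (a ↑ʳ (b ↑ʳ z)) ≡ (a + b) ↑ʳ z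
unreassoc-₃ {a} {b} {c} z rewrite FinP.splitAt-↑ʳ a (b + c) (b ↑ʳ z) | FinP.splitAt-↑ʳ b c z = refl

+-assoc-↔ : ∀ {a b c} → Fin ((a + b) + c) ↔ Fin (a + (b + c))
+-assoc-↔ {a} {b} {c} = mk↔ₛ′ (reassoc {a} {b} {c}) (unreassoc {a} {b} {c}) inverseˡ inverseʳ
  where
  inverseˡ : ∀ y → reassoc {a} {b} {c} (unreassoc {a} {b} {c} y) ≡ y
  inverseˡ y with view₃ʳ a b c y
  ... | r₁ p rewrite unreassoc-₁ {a} {b} {c} p | reassoc-₁ {a} {b} {c} p = refl
  ... | r₂ q rewrite unreassoc-₂ {a} {b} {c} q | reassoc-₂ {a} {b} {c} q = refl
  ... | r₃ z rewrite unreassoc-₃ {a} {b} {c} z | reassoc-₃ {a} {b} {c} z = refl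
  inverseʳ : ∀ x → unreassoc {a} {b} {c} (reassoc {a} {b} {c} x) ≡ x
  inverseʳ x with view₃ˡ a b c x
  ... | l₁ p rewrite reassoc-₁ {a} {b} {c} p | unreassoc-₁ {a} {b} {c} p = refl
  ... | l₂ q rewrite reassoc-₂ {a} {b} {c} q | unreassoc-₂ {a} {b} {c} q = refl
  ... | l₃ z rewrite reassoc-₃ {a} {b} {c} z | unreassoc-₃ {a} {b} {c} z = refl

⊔-assoc : ∀ C D E → MCIso ((C ⊔MC D) ⊔MC E) (C ⊔MC (D ⊔MC E))
⊔-assoc C D E = record { σ = +-assoc-↔ {n C} {n D} {n E} ; τ = +-assoc-↔ {r C} {r D} {r E} ; A-pres = A-eq ; le-pres = le-eq }
  where
  A-eq : ∀ i k → A (C ⊔MC (D ⊔MC E)) (reassoc {r C} {r D} {r E} i) (reassoc {n C} {n D} {n E} k) ≡ A ((C ⊔MC D) ⊔MC E) i k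
  A-eq i k with view₃ˡ (r C) (r D) (r E) i | view₃ˡ (n C) (n D) (n E) k
  ... | l₁ i₀ | l₁ k₀ rewrite reassoc-₁ {r C} {r D} {r E} i₀ | reassoc-₁ {n C} {n D} {n E} k₀ | A-ll C (D ⊔MC E) i₀ k₀ | A-ll (C ⊔MC D) E (i₀ ↑ˡ r D) (k₀ ↑ˡ n D) | A-ll C D i₀ k₀ = refl
  ... | l₁ i₀ | l₂ k₀ rewrite reassoc-₁ {r C} {r D} {r E} i₀ | reassoc-₂ {n C} {n D} {n E} k₀ | A-lr C (D ⊔MC E) i₀ (k₀ ↑ˡ n E) | A-ll (C ⊔MC D) E (i₀ ↑ˡ r D) (n C ↑ʳ k₀) | A-lr C D i₀ k₀ = refl
  ... | l₁ i₀ | l₃ k₀ rewrite reassoc-₁ {r C} {r D} {r E} i₀ | reassoc-₃ {n C} {n D} {n E} k₀ | A-lr C (D ⊔MC E) i₀ (n D ↑ʳ k₀) | A-lr (C ⊔MC D) E (i₀ ↑ˡ r D) k₀ = refl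
  ... | l₂ i₀ | l₁ k₀ rewrite reassoc-₂ {r C} {r D} {r E} i₀ | reassoc-₁ {n C} {n D} {n E} k₀ | A-rl C (D ⊔MC E) (i₀ ↑ˡ r E) k₀ | A-ll (C ⊔MC D) E (r C ↑ʳ i₀) (k₀ ↑ˡ n D) | A-rl C D i₀ k₀ = refl
  ... | l₂ i₀ | l₂ k₀ rewrite reassoc-₂ {r C} {r D} {r E} i₀ | reassoc-₂ {n C} {n D} {n E} k₀ | A-rr C (D ⊔MC E) (i₀ ↑ˡ r E) (k₀ ↑ˡ n E) | A-ll D E i₀ k₀ | A-ll (C ⊔MC D) E (r C ↑ʳ i₀) (n C ↑ʳ k₀) | A-rr C D i₀ k₀ = refl
  ... | l₂ i₀ | l₃ k₀ rewrite reassoc-₂ {r C} {r D} {r E} i₀ | reassoc-₃ {n C} {n D} {n E} k₀ | A-rr C (D ⊔MC E) (i₀ ↑ˡ r E) (n D ↑ʳ k₀) | A-lr D E i₀ k₀ | A-lr (C ⊔MC D) E (r C ↑ʳ i₀) k₀ = refl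
  ... | l₃ i₀ | l₁ k₀ rewrite reassoc-₃ {r C} {r D} {r E} i₀ | reassoc-₁ {n C} {n D} {n E} k₀ | A-rl C (D ⊔MC E) (r D ↑ʳ i₀) k₀ | A-rl (C ⊔MC D) E i₀ (k₀ ↑ˡ n D) = refl
  ... | l₃ i₀ | l₂ k₀ rewrite reassoc-₃ {r C} {r D} {r E} i₀ | reassoc-₂ {n C} {n D} {n E} k₀ | A-rr C (D ⊔MC E) (r D ↑ʳ i₀) (k₀ ↑ˡ n E) | A-rl D E i₀ k₀ | A-rl (C ⊔MC D) E i₀ (n C ↑ʳ k₀) = refl
  ... | l₃ i₀ | l₃ k₀ rewrite reassoc-₃ {r C} {r D} {r E} i₀ | reassoc-₃ {n C} {n D} {n E} k₀ | A-rr C (D ⊔MC E) (r D ↑ʳ i₀) (n D ↑ʳ k₀) | A-rr D E i₀ k₀ | A-rr (C ⊔MC D) E i₀ k₀ = refl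
  le-eq : ∀ i j → le (C ⊔MC (D ⊔MC E)) (reassoc {r C} {r D} {r E} i) (reassoc {r C} {r D} {r E} j) ≡ le ((C ⊔MC D) ⊔MC E) i j
  le-eq i k with view₃ˡ (r C) (r D) (r E) i | view₃ˡ (r C) (r D) (r E) k
  ... | l₁ i₀ | l₁ k₀ rewrite reassoc-₁ {r C} {r D} {r E} i₀ | reassoc-₁ {r C} {r D} {r E} k₀ | le-ll C (D ⊔MC E) i₀ k₀ | le-ll (C ⊔MC D) E (i₀ ↑ˡ r D) (k₀ ↑ˡ r D) | le-ll C D i₀ k₀ = refl
  ... | l₁ i₀ | l₂ k₀ rewrite reassoc-₁ {r C} {r D} {r E} i₀ | reassoc-₂ {r C} {r D} {r E} k₀ | le-lr C (D ⊔MC E) i₀ (k₀ ↑ˡ r E) | le-ll (C ⊔MC D) E (i₀ ↑ˡ r D) (r C ↑ʳ k₀) | le-lr C D i₀ k₀ = refl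
  ... | l₁ i₀ | l₃ k₀ rewrite reassoc-₁ {r C} {r D} {r E} i₀ | reassoc-₃ {r C} {r D} {r E} k₀ | le-lr C (D ⊔MC E) i₀ (r D ↑ʳ k₀) | le-lr (C ⊔MC D) E (i₀ ↑ˡ r D) k₀ = refl
  ... | l₂ i₀ | l₁ k₀ rewrite reassoc-₂ {r C} {r D} {r E} i₀ | reassoc-₁ {r C} {r D} {r E} k₀ | le-rl C (D ⊔MC E) (i₀ ↑ˡ r E) k₀ | le-ll (C ⊔MC D) E (r C ↑ʳ i₀) (k₀ ↑ˡ r D) | le-rl C D i₀ k₀ = refl
  ... | l₂ i₀ | l₂ k₀ rewrite reassoc-₂ {r C} {r D} {r E} i₀ | reassoc-₂ {r C} {r D} {r E} k₀ | le-rr C (D ⊔MC E) (i₀ ↑ˡ r E) (k₀ ↑ˡ r E) | le-ll D E i₀ k₀ | le-ll (C ⊔MC D) E (r C ↑ʳ i₀) (r C ↑ʳ k₀) | le-rr C D i₀ k₀ = refl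
  ... | l₂ i₀ | l₃ k₀ rewrite reassoc-₂ {r C} {r D} {r E} i₀ | reassoc-₃ {r C} {r D} {r E} k₀ | le-rr C (D ⊔MC E) (i₀ ↑ˡ r E) (r D ↑ʳ k₀) | le-lr D E i₀ k₀ | le-lr (C ⊔MC D) E (r C ↑ʳ i₀) k₀ = refl
  ... | l₃ i₀ | l₁ k₀ rewrite reassoc-₃ {r C} {r D} {r E} i₀ | reassoc-₁ {r C} {r D} {r E} k₀ | le-rl C (D ⊔MC E) (r D ↑ʳ i₀) k₀ | le-rl (C ⊔MC D) E i₀ (k₀ ↑ˡ r D) = refl
  ... | l₃ i₀ | l₂ k₀ rewrite reassoc-₃ {r C} {r D} {r E} i₀ | reassoc-₂ {r C} {r D} {r E} k₀ | le-rr C (D ⊔MC E) (r D ↑ʳ i₀) (k₀ ↑ˡ r E) | le-rl D E i₀ k₀ | le-rl (C ⊔MC D) E i₀ (r C ↑ʳ k₀) = refl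
  ... | l₃ i₀ | l₃ k₀ rewrite reassoc-₃ {r C} {r D} {r E} i₀ | reassoc-₃ {r C} {r D} {r E} k₀ | le-rr C (D ⊔MC E) (r D ↑ʳ i₀) (r D ↑ʳ k₀) | le-rr D E i₀ k₀ | le-rr (C ⊔MC D) E i₀ k₀ = refl

restrictᵛ : (C : MC) → Vec Bool (n C) → MC
restrictᵛ C v = restrict C (lookup v)

restrictᵛ-≡ : ∀ C {u u′} → u ≡ u′ → MCIso (restrictᵛ C u) (restrictᵛ C u′)
restrictᵛ-≡ C refl = MCIso-refl _

restrict-cong : ∀ C X X′ → (∀ k → X k ≡ X′ k) → MCIso (restrict C X) (restrict C X′)
restrict-cong C X X′ h = sameImage⇒MCIso (restrict-full C X) (restrict-full C X′)
  (λ k i → emb-onto X′ k (trans (sym (h k)) (emb-image X k i)))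
  (λ k i → emb-onto X k (trans (h k) (emb-image X′ k i)))

restrict-all : ∀ C X → (∀ k → X k ≡ true) → MCIso C (restrict C X)
restrict-all C X h = sameImage⇒MCIso (id-full C) (restrict-full C X) (λ k _ → emb-onto X k (h k)) (λ k _ → k , refl)

n≡0⇒MCIso-∅ : ∀ E → IsMC E → n E ≡ 0 → MCIso E ∅MC
n≡0⇒MCIso-∅ (mc .0 zero _ _) v refl = record { σ = ↔-refl ; τ = ↔-refl ; A-pres = λ () ; le-pres = λ () }
n≡0⇒MCIso-∅ (mc .0 (suc _) _ _) v refl with IsMC.nonempty v zero
... | () , _

count-false : ∀ m → count (lookup (replicate m false)) ≡ 0
count-false zero = refl
count-false (suc m) = count-false m

restrict-restrict : ∀ C (u : Vec Bool (n C)) (w : Vec Bool (count (lookup u))) →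
                    MCIso (restrict (restrictᵛ C u) (lookup w)) (restrictᵛ C (within u w))
restrict-restrict C u w =
  sameImage⇒MCIso (∘-full (restrict-full C (lookup u)) (restrict-full (restrictᵛ C u) (lookup w)))
                  (restrict-full C (lookup (within u w))) fwd bwd
  where
  fwd : ∀ k → Image (emb (lookup u) ∘ emb (lookup w)) k → Image (emb (lookup (within u w))) k
  fwd k (j , refl) = emb-onto _ _ (trans (within-emb u w (emb (lookup w) j)) (emb-member (lookup w) j))
  bwd : ∀ k → Image (emb (lookup (within u w))) k → Image (emb (lookup u) ∘ emb (lookup w)) k
  bwd k i with emb-image _ k i
  ... | mt with emb-onto (lookup u) k (within-⊆ u w k mt)
  ... | j , refl with emb-onto (lookup w) j (trans (sym (within-emb u w j)) mt)
  ... | j′ , refl = j′ , refl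

restrict-⊔ : ∀ C D (v : Vec Bool (n C)) (w : Vec Bool (n D)) →
             MCIso (restrictᵛ C v ⊔MC restrictᵛ D w) (restrictᵛ (C ⊔MC D) (v Vec.++ w))
restrict-⊔ C D v w = MCIso-trans (restrictAlong-⊔ {C} {D} {e = ev} {fv} {ew} {fw})
  (sameImage⇒MCIso (⊕-full {C} {D} {e = ev} {fv} {ew} {fw} (restrict-full C (lookup v)) (restrict-full D (lookup w)))
            (restrict-full (C ⊔MC D) (lookup (v Vec.++ w))) fwd bwd)
  where
  ev : Fin (count (lookup v)) → Fin (n C)
  ev = emb (lookup v)
  ew : Fin (count (lookup w)) → Fin (n D)
  ew = emb (lookup w)
  fv : Fin (count (λ i → suppIn (A C i) (lookup v))) → Fin (r C)
  fv = emb (λ i → suppIn (A C i) (lookup v))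
  fw : Fin (count (λ i → suppIn (A D i) (lookup w))) → Fin (r D)
  fw = emb (λ i → suppIn (A D i) (lookup w))
  fwd : ∀ k → Image (⊕-map ev ew) k → Image (emb (lookup (v Vec.++ w))) k
  fwd k (x , refl) with splitView (count (lookup v)) (count (lookup w)) x
  ... | inl x₁ rewrite ⊕-map-↑ˡ ev ew x₁ = emb-onto _ _ (trans (VecP.lookup-++ˡ v w (ev x₁)) (emb-member (lookup v) x₁))
  ... | inr x₂ rewrite ⊕-map-↑ʳ ev ew x₂ = emb-onto _ _ (trans (VecP.lookup-++ʳ v w (ew x₂)) (emb-member (lookup w) x₂))
  bwd : ∀ k → Image (emb (lookup (v Vec.++ w))) k → Image (⊕-map ev ew) k
  bwd k i with emb-image _ k i
  ... | t with splitView (n C) (n D) k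
  ... | inl k₁ with emb-onto (lookup v) k₁ (trans (sym (VecP.lookup-++ˡ v w k₁)) t)
  ... | j , refl = j ↑ˡ _ , ⊕-map-↑ˡ ev ew j
  bwd k i | t | inr k₂ with emb-onto (lookup w) k₂ (trans (sym (VecP.lookup-++ʳ v w k₂)) t)
  ... | j , refl = _ ↑ʳ j , ⊕-map-↑ʳ ev ew j

restrict-MCIso : ∀ C C′ (φ : MCIso C C′) (Y : Vec Bool (n C′)) →
                 MCIso (restrictᵛ C (permute (MCIso.σ φ) Y)) (restrictᵛ C′ Y)
restrict-MCIso C C′ φ Y =
  MCIso-trans (proj₂ moved) (sameImage⇒MCIso (proj₁ moved) (restrict-full C′ (lookup Y)) fwd bwd)
  where
  open MCIso φ
  X : Vec Bool (n C)
  X = permute σ Y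
  keep : Fin (r C) → Bool
  keep i = suppIn (A C i) (lookup X)
  moved : FullEmbedding C′ (to σ ∘ emb (lookup X)) (to τ ∘ emb keep) ×
          MCIso (restrictᵛ C X) (restrictAlong C′ (to σ ∘ emb (lookup X)) (to τ ∘ emb keep))
  moved = MCIso-full φ (restrict-full C (lookup X))
  fwd : ∀ k → Image (to σ ∘ emb (lookup X)) k → Image (emb (lookup Y)) k
  fwd k (j , refl) = emb-onto _ _ (trans (sym (VecP.lookup∘tabulate (λ i → lookup Y (to σ i)) (emb (lookup X) j)))
                                        (emb-member (lookup X) j))
  bwd : ∀ k → Image (emb (lookup Y)) k → Image (to σ ∘ emb (lookup X)) k
  bwd k i with emb-onto (lookup X) (from σ k)
                 (trans (VecP.lookup∘tabulate (λ i → lookup Y (to σ i)) (from σ k))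
                        (trans (cong (lookup Y) (to∘from σ k)) (emb-image _ k i)))
  ... | j , eq = j , trans (cong (to σ) eq) (to∘from σ k)

restrict-MCIso-complement : ∀ C C′ (φ : MCIso C C′) (Y : Vec Bool (n C′)) →
                            MCIso (restrictᵛ C (Vec.map not (permute (MCIso.σ φ) Y))) (restrictᵛ C′ (Vec.map not Y))
restrict-MCIso-complement C C′ φ Y =
  MCIso-trans (restrictᵛ-≡ C (map-not-permute (MCIso.σ φ) Y)) (restrict-MCIso C C′ φ (Vec.map not Y))

∅-isMC : IsMC ∅MC
∅-isMC = record { nonempty = λ () ; le-refl = λ () ; le-antisym = λ () ; le-trans = λ ()
                ; singleton = λ () ; singleton-le = λ () ; contained = λ () }

module HopfStructure {c ℓ} (K : Field c ℓ) where
  open LinearCombinations K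
  open HC K
  open K using (Carrier; _≈_; _*_; -_; 0#; 1#)

  _≅₂_ : MC × MC → MC × MC → Set
  _≅₂_ = R× MCIso MCIso

  ≅₂-refl : ∀ b → b ≅₂ b
  ≅₂-refl (x , y) = MCIso-refl x , MCIso-refl y

  _≅₃_ : MC × (MC × MC) → MC × (MC × MC) → Set
  _≅₃_ = R× MCIso _≅₂_

  ≅₃-refl : ∀ b → b ≅₃ b
  ≅₃-refl (x , y) = MCIso-refl x , ≅₂-refl y

  _≅₃′_ : (MC × MC) × MC → (MC × MC) × MC → Set
  _≅₃′_ = R× _≅₂_ MCIso

  ≅₃′-refl : ∀ b → b ≅₃′ b
  ≅₃′-refl (x , y) = ≅₂-refl x , MCIso-refl y

  _≈[H⊗H]⊗H_ : FV ((MC × MC) × MC) → FV ((MC × MC) × MC) → Set (c ⊔ ℓ)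
  _≈[H⊗H]⊗H_ = Eqv _≅₃′_

  module H₁ = EqvProperties MCIso MCIso-refl
  module H₂ = EqvProperties _≅₂_ ≅₂-refl
  module H₃ = EqvProperties _≅₃_ ≅₃-refl
  module H₃′ = EqvProperties _≅₃′_ ≅₃′-refl

  pair : ∀ {A B : Set} → A → B → FV (A × B)
  pair x y = (1# , (x , y)) ∷ []

  basis-⊔ : MC → MC → H
  basis-⊔ C D = basis (C ⊔MC D)

  μᵇ : MC × MC → H
  μᵇ (C , D) = basis-⊔ C D

  mul : H → H → H
  mul = bilin basis-⊔

  basis-⊔-congˡ : ∀ {C C′} D → MCIso C C′ → basis-⊔ C D ≈H basis-⊔ C′ D
  basis-⊔-congˡ D φ = single-cong (⊔-MCIso φ (MCIso-refl D))

  basis-⊔-congʳ : ∀ C {D D′} → MCIso D D′ → basis-⊔ C D ≈H basis-⊔ C D′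
  basis-⊔-congʳ C ψ = single-cong (⊔-MCIso (MCIso-refl C) ψ)

  ·≈mul : ∀ x y → (x · y) ≈H mul x y
  ·≈mul x y =
    e-trans (H₁.lin-∘ (λ C → lin (pair C) y) μᵇ x)
      (H₁.lin-congᶠ _ _ x (λ C →
         e-trans (H₁.lin-∘ (pair C) μᵇ y) (H₁.lin-congᶠ _ _ y (λ D → H₁.lin-basis μᵇ (C , D)))))

  mul-congˡ : ∀ {x x′} y → x ≈H x′ → mul x y ≈H mul x′ y
  mul-congˡ y p = H₁.lin-cong (λ C → lin (basis-⊔ C) y) (λ φ → H₁.lin-congᶠ _ _ y (λ D → basis-⊔-congˡ D φ)) p

  mul-congʳ : ∀ x {y y′} → y ≈H y′ → mul x y ≈H mul x y′
  mul-congʳ x p = H₁.lin-congᶠ _ _ x (λ C → H₁.lin-cong (basis-⊔ C) (basis-⊔-congʳ C) p)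

  ·-assoc : ∀ x y z → ((x · y) · z) ≈H (x · (y · z))
  ·-assoc x y z = begin
    (x · y) · z                                ≈⟨ ·≈mul (x · y) z ⟩
    mul (x · y) z                              ≈⟨ mul-congˡ z (·≈mul x y) ⟩
    mul (mul x y) z                            ≈⟨ lhs ⟩
    Tn (λ C D E → (C ⊔MC D) ⊔MC E)             ≈⟨ mid ⟩
    Tn (λ C D E → C ⊔MC (D ⊔MC E))             ≈⟨ rhs ⟨
    mul x (mul y z)                            ≈⟨ mul-congʳ x (·≈mul y z) ⟨
    mul x (y · z)                              ≈⟨ ·≈mul x (y · z) ⟨
    x · (y · z)                                ∎
    where
    open H₁.≋-Reasoning
    Tn : (MC → MC → MC → MC) → H
    Tn h = lin (λ C → lin (λ D → lin (λ E → basis (h C D E)) z) y) x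
    lhs : mul (mul x y) z ≈H Tn (λ C D E → (C ⊔MC D) ⊔MC E)
    lhs = e-trans (H₁.lin-∘ (λ C → lin (basis-⊔ C) y) (λ P → lin (basis-⊔ P) z) x)
            (H₁.lin-congᶠ _ _ x (λ C → e-trans (H₁.lin-∘ (basis-⊔ C) (λ P → lin (basis-⊔ P) z) y)
              (H₁.lin-congᶠ _ _ y (λ D → H₁.lin-basis (λ P → lin (basis-⊔ P) z) (C ⊔MC D)))))
    rhs : mul x (mul y z) ≈H Tn (λ C D E → C ⊔MC (D ⊔MC E))
    rhs = H₁.lin-congᶠ _ _ x (λ C → e-trans (H₁.lin-∘ (λ D → lin (basis-⊔ D) z) (basis-⊔ C) y)
            (H₁.lin-congᶠ _ _ y (λ D → e-trans (H₁.lin-∘ (basis-⊔ D) (basis-⊔ C) z)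
              (H₁.lin-congᶠ _ _ z (λ E → H₁.lin-basis (basis-⊔ C) (D ⊔MC E))))))
    mid : Tn (λ C D E → (C ⊔MC D) ⊔MC E) ≈H Tn (λ C D E → C ⊔MC (D ⊔MC E))
    mid = H₁.lin-congᶠ _ _ x (λ C → H₁.lin-congᶠ _ _ y (λ D → H₁.lin-congᶠ _ _ z (λ E →
            single-cong (⊔-assoc C D E))))

  ·-identityˡ : ∀ x → (unitH · x) ≈H x
  ·-identityˡ x = e-trans (·≈mul unitH x) (e-trans (H₁.lin-basis (λ C → lin (basis-⊔ C) x) ∅MC)
                 (e-trans (H₁.lin-congᶠ _ _ x (λ D → single-cong (⊔-identityˡ D))) (H₁.lin-identity x)))

  ·-identityʳ : ∀ x → (x · unitH) ≈H x
  ·-identityʳ x = e-trans (·≈mul x unitH) (e-trans (H₁.lin-congᶠ _ _ x (λ C →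
                 e-trans (H₁.lin-basis (basis-⊔ C) ∅MC) (single-cong (⊔-identityʳ C)))) (H₁.lin-identity x))

  εb-n : ∀ C C′ → n C ≡ n C′ → εb C ≡ εb C′
  εb-n (mc m _ _ _) (mc .m _ _ _) refl = refl

  εb-suc : ∀ E m → n E ≡ suc m → εb E ≡ 0#
  εb-suc (mc .(suc m) _ _ _) m refl = refl

  εb-zero : ∀ E → n E ≡ 0 → εb E ≡ 1#
  εb-zero (mc .0 _ _ _) refl = refl

  εb-MCIso : ∀ C C′ → MCIso C C′ → εb C ≈ εb C′
  εb-MCIso C C′ φ = K.reflexive (εb-n C C′ (↔⇒≡ (MCIso.σ φ)))

  εb-⊔ : ∀ C D → εb (C ⊔MC D) ≈ εb C * εb D
  εb-⊔ (mc zero    _ _ _) (mc zero    _ _ _) = K.sym (K.*-identityˡ 1#)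
  εb-⊔ (mc zero    _ _ _) (mc (suc _) _ _ _) = K.sym (K.*-identityˡ 0#)
  εb-⊔ (mc (suc _) _ _ _) D                  = K.sym (K.zeroˡ (εb D))

  ε-unit : ε unitH ≈ 1#
  ε-unit = K.trans (K.+-identityʳ _) (K.*-identityˡ 1#)

  ε-cong : ∀ {x y} → x ≈H y → ε x ≈ ε y
  ε-cong = linK-cong εb (λ {C} {C′} φ → εb-MCIso C C′ φ)

  ε-mult : ∀ x y → ε (x · y) ≈ (ε x * ε y)
  ε-mult x y =
    K.trans (ε-cong (·≈mul x y))
    (K.trans (linK-lin εb (λ C → lin (basis-⊔ C) y) x)
    (K.trans (linK-congᶠ _ _ x (λ C →
       K.trans (linK-lin εb (basis-⊔ C) y)
       (K.trans (linK-congᶠ _ _ y (λ D →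
          K.trans (K.+-identityʳ _) (K.trans (K.*-identityˡ _) (εb-⊔ C D))))
       (linK-*ˡ (εb C) εb y))))
    (linK-*ʳ (ε y) εb x)))

  halves : (C : MC) → Vec Bool (n C) → MC × MC
  halves C v = restrictᵛ C v , restrictᵛ C (Vec.map not v)

  Δᵛ : MC → H⊗H
  Δᵛ C = ∑ (n C) (λ v → (1# , halves C v) ∷ [])

  Δb≈Δᵛ : ∀ C → Δb C ≈H⊗H Δᵛ C
  Δb≈Δᵛ C =
    e-trans (H₂.≡⇒≋ (map-singletons (subsets (n C))))
    (e-trans (H₂.concat-subsets (n C) (λ X → term X ∷ [])
               (λ f f′ eq → single-cong (restrict-cong C f f′ eq ,
                                           restrict-cong C _ _ (λ k → cong not (eq k)))))
    (H₂.∑-cong (n C) (λ v → single-cong (MCIso-refl _ ,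
        restrict-cong C _ _ (λ k → sym (VecP.lookup-map k not v))))))
    where
    term : (Fin (n C) → Bool) → Carrier × (MC × MC)
    term X = 1# , (restrict C X , restrict C (λ k → not (X k)))
    map-singletons : ∀ L → map term L ≡ concat (map (λ X → term X ∷ []) L)
    map-singletons []      = refl
    map-singletons (X ∷ L) = cong (term X ∷_) (map-singletons L)

  Δb-MCIso : ∀ C C′ → MCIso C C′ → Δb C ≈H⊗H Δb C′
  Δb-MCIso C C′ φ =
    e-trans (Δb≈Δᵛ C)
    (e-trans (H₂.∑-permute (n C) (n C′) σ (λ v → (1# , halves C v) ∷ []))
    (e-trans (H₂.∑-cong (n C′) (λ Y →
               single-cong (restrict-MCIso C C′ φ Y , restrict-MCIso-complement C C′ φ Y)))
    (e-sym (Δb≈Δᵛ C′))))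
    where open MCIso φ

  Δ-cong : ∀ {x y} → x ≈H y → Δ x ≈H⊗H Δ y
  Δ-cong = H₂.lin-cong Δb (λ {C} {C′} φ → Δb-MCIso C C′ φ)

  Δ-unit : Δ unitH ≈H⊗H ((1# , (∅MC , ∅MC)) ∷ [])
  Δ-unit = e-trans (H₂.lin-basis Δb ∅MC) (e-trans (Δb≈Δᵛ ∅MC)
              (single-cong (restrict-∅ (lookup []) , restrict-∅ (lookup (Vec.map not [])))))
    where
    restrict-∅ : ∀ X → MCIso (restrict ∅MC X) ∅MC
    restrict-∅ X = n≡0⇒MCIso-∅ _ (restrict-isMC ∅MC X ∅-isMC) refl

  ε⊗1 : MC × MC → H
  ε⊗1 (C , D) = (εb C , D) ∷ []

  1⊗ε : MC × MC → H
  1⊗ε (C , D) = (εb D , C) ∷ []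

  counitˡ-basis : ∀ C → lin ε⊗1 (Δb C) ≈H basis C
  counitˡ-basis C = begin
    lin ε⊗1 (Δb C)                    ≈⟨ H₁.lin-cong ε⊗1 (λ { {P , _} {P′ , _} (φ , ψ) → e-cons (εb-MCIso P P′ φ) ψ e-refl }) (Δb≈Δᵛ C) ⟩
    lin ε⊗1 (Δᵛ C)                    ≈⟨ H₁.lin-∑-basis ε⊗1 (n C) (halves C) ⟩
    ∑ (n C) (λ v → ε⊗1 (halves C v))  ≈⟨ H₁.∑-single (n C) _ none (λ v v≢none →
                                           H₁.kill (K.reflexive (εb-suc (restrictᵛ C v) _ (proj₂ (count-nonzero v v≢none))))) ⟩
    ε⊗1 (halves C none)               ≈⟨ e-cons (K.reflexive (εb-zero (restrictᵛ C none) (count-false (n C))))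
                                                (MCIso-sym (restrict-all C (lookup (Vec.map not none)) (not-none (n C)))) e-refl ⟩
    basis C                           ∎
    where
    open H₁.≋-Reasoning
    none : Vec Bool (n C)
    none = replicate (n C) false

  counitʳ-basis : ∀ C → lin 1⊗ε (Δb C) ≈H basis C
  counitʳ-basis C = begin
    lin 1⊗ε (Δb C)                    ≈⟨ H₁.lin-cong 1⊗ε (λ { {_ , Q} {_ , Q′} (φ , ψ) → e-cons (εb-MCIso Q Q′ ψ) φ e-refl }) (Δb≈Δᵛ C) ⟩
    lin 1⊗ε (Δᵛ C)                    ≈⟨ H₁.lin-∑-basis 1⊗ε (n C) (halves C) ⟩
    ∑ (n C) (λ v → 1⊗ε (halves C v))  ≈⟨ H₁.∑-single (n C) _ all (λ v v≢all →
                                           H₁.kill (K.reflexive (εb-suc (restrictᵛ C (Vec.map not v)) _ (proj₂ (count-not-nonzero v v≢all))))) ⟩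
    1⊗ε (halves C all)                ≈⟨ e-cons (K.reflexive (εb-zero (restrictᵛ C (Vec.map not all)) (count-not-all (n C))))
                                                (MCIso-sym (restrict-all C (lookup all) (all-true (n C)))) e-refl ⟩
    basis C                           ∎
    where
    open H₁.≋-Reasoning
    all : Vec Bool (n C)
    all = replicate (n C) true

  ε-counitˡ : ∀ x → lin ε⊗1 (Δ x) ≈H x
  ε-counitˡ x = e-trans (H₁.lin-∘ Δb ε⊗1 x) (e-trans (H₁.lin-congᶠ _ basis x counitˡ-basis) (H₁.lin-identity x))

  ε-counitʳ : ∀ x → lin 1⊗ε (Δ x) ≈H x
  ε-counitʳ x = e-trans (H₁.lin-∘ Δb 1⊗ε x) (e-trans (H₁.lin-congᶠ _ basis x counitʳ-basis) (H₁.lin-identity x))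

  mul₂ : MC × MC → MC × MC → H⊗H
  mul₂ = λ { (a , b) (c′ , d) → (1# , (a ⊔MC c′ , b ⊔MC d)) ∷ [] }

  mul₂-congˡ : ∀ {p p′} q → p ≅₂ p′ → mul₂ p q ≈H⊗H mul₂ p′ q
  mul₂-congˡ (c′ , d) (φ , ψ) = single-cong (⊔-MCIso φ (MCIso-refl c′) , ⊔-MCIso ψ (MCIso-refl d))

  mul₂-congʳ : ∀ p {q q′} → q ≅₂ q′ → mul₂ p q ≈H⊗H mul₂ p q′
  mul₂-congʳ (a , b) (φ , ψ) = single-cong (⊔-MCIso (MCIso-refl a) φ , ⊔-MCIso (MCIso-refl b) ψ)

  bilin-mul₂-cong : ∀ {X X′ Y Y′} → X ≈H⊗H X′ → Y ≈H⊗H Y′ → bilin mul₂ X Y ≈H⊗H bilin mul₂ X′ Y′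
  bilin-mul₂-cong {X} {X′} {Y} {Y′} p q =
    e-trans (H₂.lin-cong (λ a → lin (mul₂ a) Y) (λ {a} {a′} φ → H₂.lin-congᶠ _ _ Y (λ b → mul₂-congˡ b φ)) p)
            (H₂.lin-congᶠ _ _ X′ (λ a → H₂.lin-cong (mul₂ a) (mul₂-congʳ a) q))

  Δb-⊔ : ∀ C D → Δb (C ⊔MC D) ≈H⊗H bilin mul₂ (Δb C) (Δb D)
  Δb-⊔ C D = begin
    Δb (C ⊔MC D)                                                            ≈⟨ Δb≈Δᵛ (C ⊔MC D) ⟩
    Δᵛ (C ⊔MC D)                                                            ≈⟨ H₂.∑-split (n C) (n D) _ ⟩
    ∑ (n C) (λ v → ∑ (n D) (λ w → (1# , halves (C ⊔MC D) (v Vec.++ w)) ∷ [])) ≈⟨ H₂.∑-cong (n C) (λ v →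
                                                                                  H₂.∑-cong (n D) (λ w →
                                                                                  single-cong (halves-⊔ v w))) ⟩
    ∑ (n C) (λ v → ∑ (n D) (λ w → mul₂ (halves C v) (halves D w)))          ≈⟨ H₂.bilin-∑ mul₂ (n C) (n D) _ _ ⟨
    bilin mul₂ (Δᵛ C) (Δᵛ D)                                                ≈⟨ bilin-mul₂-cong (Δb≈Δᵛ C) (Δb≈Δᵛ D) ⟨
    bilin mul₂ (Δb C) (Δb D)                                                ∎
    where
    open H₂.≋-Reasoning
    halves-⊔ : ∀ v w → halves (C ⊔MC D) (v Vec.++ w) ≅₂ (restrictᵛ C v ⊔MC restrictᵛ D w ,
                                                        restrictᵛ C (Vec.map not v) ⊔MC restrictᵛ D (Vec.map not w))
    halves-⊔ v w =
      MCIso-sym (restrict-⊔ C D v w) ,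
      MCIso-trans (restrictᵛ-≡ (C ⊔MC D) (VecP.map-++ not v w)) (MCIso-sym (restrict-⊔ C D (Vec.map not v) (Vec.map not w)))

  Δ-mult : ∀ x y → Δ (x · y) ≈H⊗H (Δ x ·⊗ Δ y)
  Δ-mult x y = begin
    Δ (x · y)                                                   ≈⟨ Δ-cong (·≈mul x y) ⟩
    Δ (mul x y)                                                 ≈⟨ Δ-mul ⟩
    lin (λ C → lin (λ D → Δb (C ⊔MC D)) y) x                    ≈⟨ H₂.lin-congᶠ _ _ x (λ C →
                                                                     H₂.lin-congᶠ _ _ y (Δb-⊔ C)) ⟩
    lin (λ C → lin (λ D → bilin mul₂ (Δb C) (Δb D)) y) x        ≈⟨ Δ·⊗Δ ⟨
    Δ x ·⊗ Δ y                                                  ∎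
    where
    open H₂.≋-Reasoning
    Δ-mul : Δ (mul x y) ≈H⊗H lin (λ C → lin (λ D → Δb (C ⊔MC D)) y) x
    Δ-mul = e-trans (H₂.lin-∘ (λ C → lin (basis-⊔ C) y) Δb x)
                    (H₂.lin-congᶠ _ _ x (λ C → e-trans (H₂.lin-∘ (basis-⊔ C) Δb y)
                                                       (H₂.lin-congᶠ _ _ y (λ D → H₂.lin-basis Δb (C ⊔MC D)))))
    Δ·⊗Δ : (Δ x ·⊗ Δ y) ≈H⊗H lin (λ C → lin (λ D → bilin mul₂ (Δb C) (Δb D)) y) x
    Δ·⊗Δ = e-trans (H₂.lin-∘ Δb (λ p → lin (mul₂ p) (lin Δb y)) x)
           (e-trans (H₂.lin-congᶠ _ _ x (λ C → H₂.lin-congᶠ _ _ (Δb C) (λ p → H₂.lin-∘ Δb (mul₂ p) y)))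
                    (H₂.lin-congᶠ _ _ x (λ C → H₂.lin-comm (λ p D → lin (mul₂ p) (Δb D)) (Δb C) y)))

  assocR-scale : ∀ a (L : FV ((MC × MC) × MC)) → assocR (scale a L) ≡ scale a (assocR L)
  assocR-scale a [] = refl
  assocR-scale a (x ∷ L) = cong (_ ∷_) (assocR-scale a L)

  assocR-lin : ∀ {a} {A : Set a} (f : A → FV ((MC × MC) × MC)) xs →
               assocR (lin f xs) ≡ lin (λ p → assocR (f p)) xs
  assocR-lin f [] = refl
  assocR-lin f ((a , x) ∷ xs) =
    trans (ListP.map-++ _ (scale a (f x)) (lin f xs))
          (cong₂ _++_ (assocR-scale a (f x)) (assocR-lin f xs))

  assocR-∑ : ∀ m (h : Vec Bool m → FV ((MC × MC) × MC)) → assocR (∑ m h) ≈H⊗H⊗H ∑ m (λ v → assocR (h v))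
  assocR-∑ zero h = e-refl
  assocR-∑ (suc m) h = e-trans (assocR-∑ m (λ v → h (true ∷ v) ++ h (false ∷ v)))
                               (H₃.∑-≡ m (λ v → ListP.map-++ _ (h (true ∷ v)) (h (false ∷ v))))

  assocR-cong : ∀ {L L′} → L ≈[H⊗H]⊗H L′ → assocR L ≈H⊗H⊗H assocR L′
  assocR-cong e-refl = e-refl
  assocR-cong (e-sym p) = e-sym (assocR-cong p)
  assocR-cong (e-trans p q) = e-trans (assocR-cong p) (assocR-cong q)
  assocR-cong (e-cons a ((φ , ψ) , χ) p) = e-cons a (φ , (ψ , χ)) (assocR-cong p)
  assocR-cong e-swap = e-swap
  assocR-cong e-zero = e-zero
  assocR-cong e-merge = e-merge

  Δ⊗1 : MC × MC → FV ((MC × MC) × MC)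
  Δ⊗1 = λ { (x , y) → bilin pair (Δb x) (basis y) }

  1⊗Δ : MC × MC → FV (MC × (MC × MC))
  1⊗Δ = λ { (x , y) → bilin pair (basis x) (Δb y) }

  Δ⊗1-cong : ∀ {p p′} → p ≅₂ p′ → Δ⊗1 p ≈[H⊗H]⊗H Δ⊗1 p′
  Δ⊗1-cong {P , Q} {P′ , Q′} (φ , ψ) =
    e-trans (H₃′.lin-cong (λ a → lin (pair a) (basis Q)) (λ {a} {a′} χ → H₃′.lin-congᶠ _ _ (basis Q) (λ b → single-cong (χ , MCIso-refl b))) (Δb-MCIso P P′ φ))
            (H₃′.lin-congᶠ _ _ (Δb P′) (λ a → H₃′.lin-cong (pair a) (λ ψ → single-cong (≅₂-refl a , ψ)) {basis Q} {basis Q′} (single-cong ψ)))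

  1⊗Δ-cong : ∀ {p p′} → p ≅₂ p′ → 1⊗Δ p ≈H⊗H⊗H 1⊗Δ p′
  1⊗Δ-cong {P , Q} {P′ , Q′} (φ , ψ) =
    e-trans (H₃.lin-cong (λ a → lin (pair a) (Δb Q)) (λ {a} {a′} χ → H₃.lin-congᶠ _ _ (Δb Q) (λ b → single-cong (χ , ≅₂-refl b))) {basis P} {basis P′} (single-cong φ))
            (H₃.lin-congᶠ _ _ (basis P′) (λ a → H₃.lin-cong (pair a) (λ ψ → single-cong (MCIso-refl a , ψ)) (Δb-MCIso Q Q′ ψ)))

  Δ⊗1-∑ : ∀ P Q → Δ⊗1 (P , Q) ≈[H⊗H]⊗H ∑ (n P) (λ w → (1# , (halves P w , Q)) ∷ [])
  Δ⊗1-∑ P Q =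
    e-trans (H₃′.lin-congᶠ _ (λ a → pair a Q) (Δb P) (λ a → H₃′.lin-basis (pair a) Q))
    (e-trans (H₃′.lin-cong (λ a → pair a Q) (λ χ → single-cong (χ , MCIso-refl Q)) (Δb≈Δᵛ P))
    (H₃′.lin-∑-basis (λ a → pair a Q) (n P) (halves P)))

  1⊗Δ-∑ : ∀ P Q → 1⊗Δ (P , Q) ≈H⊗H⊗H ∑ (n Q) (λ w → (1# , (P , halves Q w)) ∷ [])
  1⊗Δ-∑ P Q =
    e-trans (H₃.lin-basis (λ a → lin (pair a) (Δb Q)) P)
    (e-trans (H₃.lin-cong (pair P) (λ ψ → single-cong (MCIso-refl P , ψ)) (Δb≈Δᵛ Q))
    (H₃.lin-∑-basis (pair P) (n Q) (halves Q)))

  coassoc-basis : ∀ C → lin (λ p → assocR (Δ⊗1 p)) (Δb C) ≈H⊗H⊗H lin 1⊗Δ (Δb C)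
  coassoc-basis C = e-trans left (e-sym right)
    where
    thirds : Vec Part (n C) → MC × (MC × MC)
    thirds z = restrictᵛ C (in₁ z) , halves (restrictᵛ C (Vec.map not (in₁ z))) (in₂-of-₂₃ z)

    regroup : ∀ z → (restrictᵛ (restrictᵛ C (in₁₂ z)) (in₁-of-₁₂ z) ,
                     restrictᵛ (restrictᵛ C (in₁₂ z)) (Vec.map not (in₁-of-₁₂ z)) ,
                     restrictᵛ C (Vec.map not (in₁₂ z))) ≅₃ thirds z
    regroup z =
      MCIso-trans (restrict-restrict C (in₁₂ z) (in₁-of-₁₂ z)) (restrictᵛ-≡ C (within-part₁ z)) ,
      MCIso-trans (restrict-restrict C (in₁₂ z) (Vec.map not (in₁-of-₁₂ z)))
        (MCIso-trans (restrictᵛ-≡ C (within-part₂ z)) (MCIso-sym (restrict-restrict C (Vec.map not (in₁ z)) (in₂-of-₂₃ z)))) ,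
      MCIso-trans (restrictᵛ-≡ C (within-part₃ z))
        (MCIso-sym (restrict-restrict C (Vec.map not (in₁ z)) (Vec.map not (in₂-of-₂₃ z))))

    left : lin (λ p → assocR (Δ⊗1 p)) (Δb C) ≈H⊗H⊗H ∑₃ (n C) (λ z → (1# , thirds z) ∷ [])
    left =
      e-trans (H₃.lin-cong (λ p → assocR (Δ⊗1 p)) (λ χ → assocR-cong (Δ⊗1-cong χ)) (Δb≈Δᵛ C))
      (e-trans (H₃.lin-∑-basis (λ p → assocR (Δ⊗1 p)) (n C) (halves C))
      (e-trans (H₃.∑-cong (n C) (λ v → e-trans (assocR-cong (Δ⊗1-∑ (restrictᵛ C v) (restrictᵛ C (Vec.map not v))))
                                               (assocR-∑ (count (lookup v)) _)))
      (e-trans (H₃.∑∑≈∑₃ˡ (n C) _)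
               (H₃.∑₃-cong (n C) (λ z → single-cong (regroup z))))))

    right : lin 1⊗Δ (Δb C) ≈H⊗H⊗H ∑₃ (n C) (λ z → (1# , thirds z) ∷ [])
    right =
      e-trans (H₃.lin-cong 1⊗Δ 1⊗Δ-cong (Δb≈Δᵛ C))
      (e-trans (H₃.lin-∑-basis 1⊗Δ (n C) (halves C))
      (e-trans (H₃.∑-cong (n C) (λ v → 1⊗Δ-∑ (restrictᵛ C v) (restrictᵛ C (Vec.map not v))))
               (H₃.∑∑≈∑₃ʳ (n C) _)))

  Δ-coassoc : ∀ x → assocR ((Δb ⊗L basis) (Δ x)) ≈H⊗H⊗H (basis ⊗L Δb) (Δ x)
  Δ-coassoc x = begin
    assocR ((Δb ⊗L basis) (Δ x))                        ≡⟨ assocR-lin Δ⊗1 (Δ x) ⟩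
    lin (λ p → assocR (Δ⊗1 p)) (Δ x)                    ≈⟨ H₃.lin-∘ Δb (λ p → assocR (Δ⊗1 p)) x ⟩
    lin (λ C → lin (λ p → assocR (Δ⊗1 p)) (Δb C)) x     ≈⟨ H₃.lin-congᶠ _ _ x coassoc-basis ⟩
    lin (λ C → lin 1⊗Δ (Δb C)) x                        ≈⟨ H₃.lin-∘ Δb 1⊗Δ x ⟨
    (basis ⊗L Δb) (Δ x)                                 ∎
    where open H₃.≋-Reasoning

  mulʳ : H → MC → H
  mulʳ L D = lin (λ P → basis-⊔ P D) L

  mulˡ : MC → H → H
  mulˡ D L = lin (basis-⊔ D) L

  antipodeTerm : (MC → H) → (C : MC) → Vec Bool (n C) → H
  antipodeTerm rec C v = dropIf (isAll v) (mulʳ (rec (restrictᵛ C v)) (restrictᵛ C (Vec.map not v)))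

  antipodeSum : (MC → H) → MC → H
  antipodeSum rec C = ∑ (n C) (antipodeTerm rec C)

  antipodeStep : (MC → H) → MC → ℕ → H
  antipodeStep rec C zero = basis ∅MC
  antipodeStep rec C (suc _) = H₁.neg (antipodeSum rec C)

  -- Fuelled S: antipodeᶠ f C is S[C] once n C ≤ f (antipodeᶠ-fuel); the fuel makes the recursion on
  -- restrictions to proper subsets structural.
  antipodeᶠ : ℕ → MC → H
  antipodeᶠ zero C = basis ∅MC
  antipodeᶠ (suc f) C = antipodeStep (antipodeᶠ f) C (n C)

  S : MC → H
  S C = antipodeᶠ (n C) C

  mulʳ-cong : ∀ {L L′ D D′} → L ≈H L′ → MCIso D D′ → mulʳ L D ≈H mulʳ L′ D′
  mulʳ-cong {L} {L′} {D} {D′} p ψ =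
    e-trans (H₁.lin-cong (λ P → basis-⊔ P D) (basis-⊔-congˡ D) p)
            (H₁.lin-congᶠ _ _ L′ (λ P → basis-⊔-congʳ P ψ))

  antipodeStep-cong : ∀ rec rec′ C k →
                      (∀ v → isAll v ≡ false → rec (restrictᵛ C v) ≈H rec′ (restrictᵛ C v)) →
                      antipodeStep rec C k ≈H antipodeStep rec′ C k
  antipodeStep-cong rec rec′ C zero    h = e-refl
  antipodeStep-cong rec rec′ C (suc k) h = H₁.scale-cong (- 1#) (H₁.∑-cong (n C) terms)
    where
    terms : ∀ v → antipodeTerm rec C v ≈H antipodeTerm rec′ C v
    terms v with isAll v in eq
    ... | true  = e-refl
    ... | false = mulʳ-cong (h v eq) (MCIso-refl _)

  antipodeStep-zero : ∀ rec C k → k ≡ 0 → antipodeStep rec C k ≡ basis ∅MC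
  antipodeStep-zero rec C .0 refl = refl

  antipodeᶠ-fuel : ∀ f f′ C → n C ≤ f → n C ≤ f′ → antipodeᶠ f C ≈H antipodeᶠ f′ C
  antipodeᶠ-fuel zero zero C p p′ = e-refl
  antipodeᶠ-fuel zero (suc g) C p p′ = H₁.≡⇒≋ (sym (antipodeStep-zero (antipodeᶠ g) C (n C) (ℕP.n≤0⇒n≡0 p)))
  antipodeᶠ-fuel (suc g) zero C p p′ = H₁.≡⇒≋ (antipodeStep-zero (antipodeᶠ g) C (n C) (ℕP.n≤0⇒n≡0 p′))
  antipodeᶠ-fuel (suc g) (suc g′) C p p′ = antipodeStep-cong (antipodeᶠ g) (antipodeᶠ g′) C (n C) (λ v na →
    antipodeᶠ-fuel g g′ (restrictᵛ C v) (ℕP.≤-pred (ℕP.≤-trans (count< v na) p)) (ℕP.≤-pred (ℕP.≤-trans (count< v na) p′)))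

  S-unfold : ∀ C m → n C ≡ suc m → S C ≈H H₁.neg (antipodeSum S C)
  S-unfold C m eq =
    e-trans (H₁.≡⇒≋ (trans (cong (λ f → antipodeᶠ f C) eq) (cong (antipodeStep (antipodeᶠ m) C) eq)))
            (antipodeStep-cong (antipodeᶠ m) S C (suc m) (λ v na →
               antipodeᶠ-fuel m (count (lookup v)) (restrictᵛ C v) (ℕP.≤-pred (subst (suc (count (lookup v)) ≤_) eq (count< v na))) ℕP.≤-refl))

  S-zero : ∀ C → n C ≡ 0 → S C ≡ basis ∅MC
  S-zero C eq = cong (λ f → antipodeᶠ f C) eq

  antipodeᶠ-inH : ∀ f C → IsMC C → InH (antipodeᶠ f C)
  antipodeᶠ-inH zero C v = ∅-isMC , _
  antipodeᶠ-inH (suc g) C vC = step-inH (n C)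
    where
    step-inH : ∀ k → InH (antipodeStep (antipodeᶠ g) C k)
    step-inH zero    = ∅-isMC , _
    step-inH (suc k) = AllB-scale (- 1#) (antipodeSum (antipodeᶠ g) C) (AllB-∑ (n C) _ term-inH)
      where
      term-inH : ∀ v → InH (antipodeTerm (antipodeᶠ g) C v)
      term-inH v with isAll v
      ... | true  = _
      ... | false = AllB-lin _ (antipodeᶠ g (restrictᵛ C v)) (antipodeᶠ-inH g (restrictᵛ C v) (restrict-isMC C _ vC))
                      (λ P vP → ⊔-isMC P (restrictᵛ C (Vec.map not v)) vP (restrict-isMC C _ vC) , _)

  antipodeᶠ-MCIso : ∀ f C C′ → n C ≤ f → MCIso C C′ → antipodeᶠ f C ≈H antipodeᶠ f C′
  antipodeᶠ-MCIso zero C C′ p φ = e-refl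
  antipodeᶠ-MCIso (suc g) C C′ p φ = step-iso (n C) (n C′) (↔⇒≡ (MCIso.σ φ))
    where
    open MCIso φ
    sum-iso : antipodeSum (antipodeᶠ g) C ≈H antipodeSum (antipodeᶠ g) C′
    sum-iso = e-trans (H₁.∑-permute (n C) (n C′) σ _) (H₁.∑-cong (n C′) term-iso)
      where
      term-iso : ∀ Y → antipodeTerm (antipodeᶠ g) C (permute σ Y) ≈H antipodeTerm (antipodeᶠ g) C′ Y
      term-iso Y rewrite isAll-permute σ Y with isAll Y in eq
      ... | true  = e-refl
      ... | false = mulʳ-cong
        (antipodeᶠ-MCIso g _ _ (ℕP.≤-pred (ℕP.≤-trans (count< (permute σ Y) (trans (isAll-permute σ Y) eq)) p)) (restrict-MCIso C C′ φ Y))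
        (restrict-MCIso-complement C C′ φ Y)
    step-iso : ∀ k k′ → k ≡ k′ → antipodeStep (antipodeᶠ g) C k ≈H antipodeStep (antipodeᶠ g) C′ k′
    step-iso zero    .zero    refl = e-refl
    step-iso (suc k) .(suc k) refl = H₁.scale-cong (- 1#) sum-iso

  S-MCIso : ∀ C C′ → MCIso C C′ → S C ≈H S C′
  S-MCIso C C′ φ = e-trans (antipodeᶠ-MCIso (n C) C C′ ℕP.≤-refl φ)
                   (antipodeᶠ-fuel (n C) (n C′) C′ (ℕP.≤-reflexive (sym e)) ℕP.≤-refl)
    where
    e : n C ≡ n C′
    e = ↔⇒≡ (MCIso.σ φ)

  S-recursion : ∀ C → (antipodeSum S C ++ S C) ≈H η (εb C)
  S-recursion C = by-size (n C) refl
    where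
    by-size : ∀ k → n C ≡ k → (antipodeSum S C ++ S C) ≈H η (εb C)
    by-size zero    eq = e-trans (H₁.++⁺ (sum-empty eq _) (H₁.≡⇒≋ (S-zero C eq)))
                                 (e-cons (K.reflexive (sym (εb-zero C eq))) (MCIso-refl _) e-refl)
      where
      sum-empty : ∀ {m} → m ≡ 0 → (h : Vec Bool m → H) → ∑ m (λ v → dropIf (isAll v) (h v)) ≈H []
      sum-empty refl h = e-refl
    by-size (suc m) eq = e-trans (H₁.++⁺ˡ (antipodeSum S C) (S-unfold C m eq))
                         (e-trans (H₁.neg-inverse (antipodeSum S C))
                         (e-sym (H₁.kill (K.reflexive (εb-suc C m eq)))))

  mulʳ-∅ : ∀ L → mulʳ L ∅MC ≈H L
  mulʳ-∅ L = e-trans (H₁.lin-congᶠ _ _ L (λ P → single-cong (⊔-identityʳ P))) (H₁.lin-identity L)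

  antipode-sumˡ : ∀ C → IsMC C →
                  ∑ (n C) (λ v → mulʳ (S (restrictᵛ C v)) (restrictᵛ C (Vec.map not v))) ≈H η (εb C)
  antipode-sumˡ C vC = begin
    ∑ (n C) (λ v → mulʳ (S (restrictᵛ C v)) (restrictᵛ C (Vec.map not v)))  ≈⟨ H₁.∑-split-all (n C) _ ⟩
    antipodeSum S C ++ mulʳ (S (restrictᵛ C all)) (restrictᵛ C (Vec.map not all))
                                                                            ≈⟨ H₁.++⁺ˡ (antipodeSum S C) last-term ⟩
    antipodeSum S C ++ S C                                                  ≈⟨ S-recursion C ⟩
    η (εb C)                                                                ∎
    where
    open H₁.≋-Reasoning
    all : Vec Bool (n C)
    all = replicate (n C) true
    last-term : mulʳ (S (restrictᵛ C all)) (restrictᵛ C (Vec.map not all)) ≈H S C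
    last-term =
      e-trans (mulʳ-cong (S-MCIso (restrictᵛ C all) C (MCIso-sym (restrict-all C (lookup all) (all-true (n C)))))
                         (n≡0⇒MCIso-∅ (restrictᵛ C (Vec.map not all)) (restrict-isMC C _ vC) (count-not-all (n C))))
              (mulʳ-∅ (S C))

  antipode-sumʳ : ∀ C → IsMC C →
                  ∑ (n C) (λ v → mulˡ (restrictᵛ C v) (S (restrictᵛ C (Vec.map not v)))) ≈H η (εb C)
  -- H is commutative, and v ↦ ¬ v exchanges the two halves.
  antipode-sumʳ C vC =
    e-trans (H₁.∑-cong (n C) (λ v → H₁.lin-congᶠ _ _ (S (restrictᵛ C (Vec.map not v)))
               (λ Q → single-cong (⊔-comm (restrictᵛ C v) Q))))
    (e-trans (H₁.∑-not (n C) _)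
    (e-trans (H₁.∑-≡ (n C) (λ v → cong (λ u → mulʳ (S (restrictᵛ C u)) (restrictᵛ C (Vec.map not v)))
                                       (map-not-involutive v)))
             (antipode-sumˡ C vC)))

  S⊗1 : MC × MC → H⊗H
  S⊗1 (C , D) = bilin pair (S C) (basis D)

  1⊗S : MC × MC → H⊗H
  1⊗S (C , D) = bilin pair (basis C) (S D)

  S·1 : MC × MC → H
  S·1 (C , D) = mulʳ (S C) D

  1·S : MC × MC → H
  1·S (C , D) = mulˡ C (S D)

  μ-S⊗1 : ∀ p → lin μᵇ (S⊗1 p) ≈H S·1 p
  μ-S⊗1 (P , Q) = e-trans (H₁.lin-∘ (λ a → lin (pair a) (basis Q)) μᵇ (S P))
                  (H₁.lin-congᶠ _ _ (S P) (λ a → e-trans (H₁.lin-∘ (pair a) μᵇ (basis Q))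
                    (e-trans (H₁.lin-basis (λ b → lin μᵇ (pair a b)) Q) (H₁.lin-basis μᵇ (a , Q)))))

  μ-1⊗S : ∀ p → lin μᵇ (1⊗S p) ≈H 1·S p
  μ-1⊗S (P , Q) = e-trans (H₁.lin-∘ (λ a → lin (pair a) (S Q)) μᵇ (basis P))
                  (e-trans (H₁.lin-basis (λ a → lin μᵇ (lin (pair a) (S Q))) P)
                  (e-trans (H₁.lin-∘ (pair P) μᵇ (S Q))
                  (H₁.lin-congᶠ _ _ (S Q) (λ b → H₁.lin-basis μᵇ (P , b)))))

  S·1-cong : ∀ {p p′} → p ≅₂ p′ → S·1 p ≈H S·1 p′
  S·1-cong {P , _} {P′ , _} (φ , ψ) = mulʳ-cong (S-MCIso P P′ φ) ψ

  1·S-cong : ∀ {p p′} → p ≅₂ p′ → 1·S p ≈H 1·S p′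
  1·S-cong {P , Q} {P′ , Q′} (φ , ψ) =
    e-trans (H₁.lin-cong (basis-⊔ P) (basis-⊔-congʳ P) (S-MCIso Q Q′ ψ))
            (H₁.lin-congᶠ _ _ (S Q′) (λ D → basis-⊔-congˡ D φ))

  μᵇ-cong : ∀ {p p′} → p ≅₂ p′ → μᵇ p ≈H μᵇ p′
  μᵇ-cong (φ , ψ) = single-cong (⊔-MCIso φ ψ)

  antipodeˡ-basis : ∀ C → IsMC C → lin μᵇ (lin S⊗1 (Δb C)) ≈H η (εb C)
  antipodeˡ-basis C vC = begin
    lin μᵇ (lin S⊗1 (Δb C))             ≈⟨ H₁.lin-∘ S⊗1 μᵇ (Δb C) ⟩
    lin (λ p → lin μᵇ (S⊗1 p)) (Δb C)   ≈⟨ H₁.lin-congᶠ _ S·1 (Δb C) μ-S⊗1 ⟩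
    lin S·1 (Δb C)                      ≈⟨ H₁.lin-cong S·1 S·1-cong (Δb≈Δᵛ C) ⟩
    lin S·1 (Δᵛ C)                      ≈⟨ H₁.lin-∑-basis S·1 (n C) (halves C) ⟩
    ∑ (n C) (λ v → S·1 (halves C v))    ≈⟨ antipode-sumˡ C vC ⟩
    η (εb C)                            ∎
    where open H₁.≋-Reasoning

  antipodeʳ-basis : ∀ C → IsMC C → lin μᵇ (lin 1⊗S (Δb C)) ≈H η (εb C)
  antipodeʳ-basis C vC = begin
    lin μᵇ (lin 1⊗S (Δb C))             ≈⟨ H₁.lin-∘ 1⊗S μᵇ (Δb C) ⟩
    lin (λ p → lin μᵇ (1⊗S p)) (Δb C)   ≈⟨ H₁.lin-congᶠ _ 1·S (Δb C) μ-1⊗S ⟩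
    lin 1·S (Δb C)                      ≈⟨ H₁.lin-cong 1·S 1·S-cong (Δb≈Δᵛ C) ⟩
    lin 1·S (Δᵛ C)                      ≈⟨ H₁.lin-∑-basis 1·S (n C) (halves C) ⟩
    ∑ (n C) (λ v → 1·S (halves C v))    ≈⟨ antipode-sumʳ C vC ⟩
    η (εb C)                            ∎
    where open H₁.≋-Reasoning

  antipodeˡ : ∀ x → InH x → μ ((S ⊗L basis) (Δ x)) ≈H η (ε x)
  antipodeˡ x vx =
    e-trans (H₁.lin-cong μᵇ μᵇ-cong
               (H₂.lin-∘ Δb S⊗1 x))
    (e-trans (H₁.lin-∘ (λ C → lin S⊗1 (Δb C)) μᵇ x)
    (e-trans (H₁.lin-congᶠ-on _ _ x vx antipodeˡ-basis)
    (H₁.lin-collect εb ∅MC x)))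

  antipodeʳ : ∀ x → InH x → μ ((basis ⊗L S) (Δ x)) ≈H η (ε x)
  antipodeʳ x vx =
    e-trans (H₁.lin-cong μᵇ μᵇ-cong
               (H₂.lin-∘ Δb 1⊗S x))
    (e-trans (H₁.lin-∘ (λ C → lin 1⊗S (Δb C)) μᵇ x)
    (e-trans (H₁.lin-congᶠ-on _ _ x vx antipodeʳ-basis)
    (H₁.lin-collect εb ∅MC x)))

  S-inH : ∀ C → IsMC C → InH (S C)
  S-inH C = antipodeᶠ-inH (n C) C

lemma3p19 : ∀ {c ℓ} (K : Field c ℓ) → CharZero K → HC.IsHopfAlgebra K
lemma3p19 K _ = record
  { ∅-valid        = ∅-isMC
  ; ⊔-valid        = ⊔-isMC
  ; restrict-valid = λ C X vC → restrict-isMC C X vC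
  ; ⊔-iso          = λ _ _ _ _ _ _ → ⊔-MCIso
  ; Δ-iso          = λ C C′ _ → Δb-MCIso C C′
  ; ε-iso          = λ C C′ _ → εb-MCIso C C′
  ; ·-assoc        = λ x y z _ _ _ → ·-assoc x y z
  ; ·-unitˡ        = λ x _ → ·-identityˡ x
  ; ·-unitʳ        = λ x _ → ·-identityʳ x
  ; Δ-coassoc      = λ x _ → Δ-coassoc x
  ; ε-counitˡ      = λ x _ → ε-counitˡ x
  ; ε-counitʳ      = λ x _ → ε-counitʳ x
  ; Δ-mult         = λ x y _ _ → Δ-mult x y
  ; Δ-unit         = Δ-unit
  ; ε-mult         = λ x y _ _ → ε-mult x y
  ; ε-unit         = ε-unit
  ; antipode       = S , S-inH , (λ C C′ _ → S-MCIso C C′) , antipodeˡ , antipodeʳ }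
  where open HopfStructure K
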